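{- Every alcove $A$ contains exactly one point $(x_1,\ldots,x_n)^T$ in its interior such that the numbers $\frac{n+1}{2}-nx_1,\ldots,\frac{n+1}{2}-nx_n$ are all integers. Moreover, if $\bar x\in\omega(A_0)$ is such a point, then $\omega^{ -1}$ has window $[\frac{n+1}{2}-nx_1,\ldots,\frac{n+1}{2}-nx_n]$, i.e. $\omega^{ -1}(i)=\frac{n+1}{2}-nx_i$ for $1\le i\le n$.
   Context: Affine permutations: bijections $\omega:\mathbb{Z}\to\mathbb{Z}$ with $\omega(x+n)=\omega(x)+n$, $\sum_{i=1}^n\omega(i)=n(n+1)/2$; the window of $\omega$ is $[\omega(1),\ldots,\omega(n)]$. The group $\widetilde{S}_n$ is generated by $s_0,\ldots,s_{n-1}$ ($s_i(x)=x+1$ if $x\equiv i$, $x-1$ if $x\equiv i+1$, $x$ otherwise, mod $n$) and acts on $V=\{x\in\mathbb{R}^n:\sum x_i=0\}$ with $s_i$ ($1\le i\le n-1$) swapping $x_i,x_{i+1}$ and $s_0(x_1,\ldots,x_n)=(x_n+1,x_2,\ldots,x_{n-1},x_1-1)$. Alcoves are connected components of $V\setminus\bigcup\{x_i-x_j=\ell\}$ ($1\le i<j\le n$, $\ell\in\mathbb{Z}$); the fundamental alcove is $A_0=\{x_1>x_2>\cdots>x_n>x_1-1\}$.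
   Formalization: Points of V, of the alcoves and of $A_0$, including the point x̄ and its preimage, are taken in ℚ^n instead of $\mathbb{R}^n$. -}

module Defs where

open import Data.Nat as ℕ using (ℕ; zero; suc; NonZero; _∸_; _<?_)
open import Data.Nat.Properties using (_≟_)
open import Data.Integer as ℤ using (ℤ; +_; _%ℕ_)
open import Data.Rational as ℚ using (ℚ; 0ℚ; 1ℚ; _/_)
open import Data.Fin using (Fin; toℕ; fromℕ<)
open import Data.List using (List; []; _∷_)
open import Data.Product using (Σ; _×_; _,_)
open import Relation.Nullary using (yes; no)
open import Relation.Binary.PropositionalEquality using (_≡_)

-- Points of ℚ^n are functions Fin n → ℚ; coordinate x_{i+1} is x i (0-indexed).
Point : ℕ → Set
Point n = Fin n → ℚ

sumℚ : ∀ {n} → Point n → ℚ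
sumℚ {zero}  x = 0ℚ
sumℚ {suc n} x = x Fin.zero ℚ.+ sumℚ (λ i → x (Fin.suc i))
  where import Data.Fin as Fin

InV : ∀ {n} → Point n → Set
InV x = sumℚ x ≡ 0ℚ

-- the element of Fin n with value i (if i < n; otherwise a fallback, never used for n ≥ 2)
idx : ∀ {n} → ℕ → Fin n → Fin n
idx {n} i fb with i <? n
... | yes p = fromℕ< p
... | no  _ = fb

-- Action of the generator s_g (g = 0,…,n-1) on V:
--  s_i (1 ≤ i ≤ n-1) swaps x_i, x_{i+1};  s_0 (x_1,…,x_n) = (x_n + 1, x_2, …, x_{n-1}, x_1 - 1).
sV : ∀ {n} → Fin n → Point n → Point n
sV {n} g x j with toℕ g
... | zero with toℕ j ≟ 0
...   | yes _ = x (idx (n ∸ 1) j) ℚ.+ 1ℚ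
...   | no  _ with toℕ j ≟ (n ∸ 1)
...     | yes _ = x (idx 0 j) ℚ.- 1ℚ
...     | no  _ = x j
sV {n} g x j | suc p with toℕ j ≟ p
...   | yes _ = x (idx (suc p) j)
...   | no  _ with toℕ j ≟ suc p
...     | yes _ = x (idx p j)
...     | no  _ = x j

sZ : ∀ {n} .{{_ : NonZero n}} → Fin n → ℤ → ℤ
sZ {n} g z with (z %ℕ n) ≟ toℕ g
... | yes _ = z ℤ.+ + 1
... | no  _ with (z %ℕ n) ≟ ((suc (toℕ g)) ℕ.% n)
...   | yes _ = z ℤ.- + 1
...   | no  _ = z

-- A word g₁ g₂ … g_k in the generators denotes ω = s_{g₁} ∘ s_{g₂} ∘ … ∘ s_{g_k}.
-- Its action as an affine permutation of ℤ:
wordZ : ∀ {n} .{{_ : NonZero n}} → List (Fin n) → ℤ → ℤ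
wordZ []      z = z
wordZ (g ∷ w) z = sZ g (wordZ w z)

wordV : ∀ {n} → List (Fin n) → Point n → Point n
wordV []      x = x
wordV (g ∷ w) x = sV g (wordV w x)

-- For i < j the hyperplanes x_i - x_j = ℓ (ℓ ∈ ℤ) cut V into strips;
-- a connected component of the complement is exactly a nonempty set of the form
-- {x ∈ V : k_{ij} < x_i - x_j < k_{ij} + 1 for all i < j} for an integer family k.
-- (Alcoves are open, so the interior of an alcove is the alcove itself.)
InAlcove : ∀ {n} → (Fin n → Fin n → ℤ) → Point n → Set
InAlcove k x = ∀ i j → toℕ i ℕ.< toℕ j →
  ((k i j / 1) ℚ.< (x i ℚ.- x j)) × ((x i ℚ.- x j) ℚ.< ((k i j ℤ.+ + 1) / 1))

IsAlcove : ∀ {n} → (Fin n → Fin n → ℤ) → Set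
IsAlcove {n} k = Σ (Point n) λ x → InV x × InAlcove k x

InA0 : ∀ {n} → Point n → Set
InA0 {n} x = InV x
  × (∀ i j → toℕ j ≡ suc (toℕ i) → x j ℚ.< x i)
  × (∀ i j → toℕ i ≡ 0 → toℕ j ≡ n ∸ 1 → (x i ℚ.- 1ℚ) ℚ.< x j)

special : (n : ℕ) → Point n → Fin n → ℚ
special n x i = (+ (suc n) / 2) ℚ.- ((+ n / 1) ℚ.* x i)

IntegralWitness : (n : ℕ) → Point n → (Fin n → ℤ) → Set
IntegralWitness n x m = ∀ i → special n x i ≡ (m i / 1)

IsIntegralPoint : (n : ℕ) → Point n → Set
IsIntegralPoint n x = Σ (Fin n → ℤ) λ m → IntegralWitness n x m

{-# OPTIONS --safe #-}
module Submission where

-- Write a point as x_i = ((n+1)/2 − m_i)/n.  Then x ∈ V iff Σ m_i = n(n+1)/2, and x lies in the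
-- alcove cut out by k iff n·K_ij < m_j − m_i < n·K_ij + n for all i ≠ j, where K extends k
-- antisymmetrically by K_ji = −1 − k_ij.  For fixed i the numbers m_j − m_i − n·K_ij are then n
-- distinct residues in [0, n), so they sum to n(n−1)/2, and this forces m_i = 1 − Σ_j K_ij:
-- uniqueness.  Conversely this window satisfies the inequalities: since ⌊a + b⌋ − ⌊a⌋ − ⌊b⌋ ∈ {0, 1},
-- m_j − m_i − n·K_ij is a sum of n such terms, one per l, the term for l = i being 1 and that for
-- l = j being 0.
--
-- The fundamental alcove is the alcove with all k_ij = 0, whose window is [1, …, n].  A generator
-- s_g exchanges two coordinates of V (shifting them by ±1 when g = 0), so if x = s_g x′ then
-- m_i = m′_π(i) − n·c_i, and s_g sends π(i) − n·c_i to i on ℤ.  As ω(z + n) = ω(z) + n,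
-- induction on a word for ω gives ω(m_i) = i.

open import Defs
open import Data.Nat using (ℕ; suc; NonZero; _≤_)
open import Data.Integer using (ℤ; +_)
open import Data.Fin using (Fin; toℕ)
open import Data.List using (List; []; _∷_)
open import Data.Product using (Σ; _×_)
open import Relation.Binary.PropositionalEquality using (_≡_)

import Data.Nat as ℕ
import Data.Nat.Properties as ℕP
import Data.Integer as ℤ
import Data.Integer.Properties as ℤP
import Data.Integer.DivMod as ℤDivMod
import Data.Nat.DivMod as ℕDivMod
import Data.Rational as ℚ
import Data.Rational.Properties as ℚP
import Data.Rational.Unnormalised as ℚᵘ
import Data.Rational.Unnormalised.Properties as ℚᵘP
import Data.Fin as Fin
import Data.Fin.Properties as FinP
import Data.Vec.Functional as Vec
open import Data.Fin.Permutation using (permutation)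
open import Data.Product using (_,_; proj₁; proj₂; ∃)
open import Data.Sum using (inj₁; inj₂)
open import Data.Empty using (⊥-elim)
open import Function using (_∘_)
open import Function.Definitions using (Injective)
open import Level using (0ℓ)
open import Relation.Binary.Core using (Rel)
open import Relation.Binary.Definitions using (Transitive; tri<; tri≈; tri>)
open import Relation.Binary.PropositionalEquality
  using (_≢_; refl; sym; trans; cong; cong₂; subst; subst₂; module ≡-Reasoning)
open import Relation.Nullary using (¬_; yes; no)
open import Relation.Nullary.Decidable using (dec⇒maybe)
open import Algebra.Properties.Semiring.Sum ℤP.+-*-semiring
  using (sum; sum-cong-≗; ∑-distrib-+; ∑-comm; sum-permute; sum-remove; *-distribˡ-sum)
open import Data.Integer.Tactic.RingSolver using (solve-∀)
import Tactic.RingSolver as RingSolver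
open import Tactic.RingSolver.Core.AlmostCommutativeRing
  using (AlmostCommutativeRing; fromCommutativeRing)

ℚ-ring : AlmostCommutativeRing 0ℓ 0ℓ
ℚ-ring = fromCommutativeRing ℚP.+-*-commutativeRing (λ x → dec⇒maybe (ℚ.0ℚ ℚP.≟ x))

ι : ℤ → ℚ.ℚ
ι i = i ℚ./ 1

private
  toℚᵘ-ι : ∀ i → ℚ.toℚᵘ (ι i) ℚᵘ.≃ ℚᵘ.mkℚᵘ i 0
  toℚᵘ-ι i = ℚP.toℚᵘ-fromℚᵘ (ℚᵘ.mkℚᵘ i 0)

ι-homo-+ : ∀ a b → ι (a ℤ.+ b) ≡ ι a ℚ.+ ι b
ι-homo-+ a b = ℚP.toℚᵘ-injective (begin-equality
  ℚ.toℚᵘ (ι (a ℤ.+ b))                ≃⟨ toℚᵘ-ι (a ℤ.+ b) ⟩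
  ℚᵘ.mkℚᵘ (a ℤ.+ b) 0                 ≃⟨ ℚᵘ.*≡* (times-one a b) ⟩
  ℚᵘ.mkℚᵘ a 0 ℚᵘ.+ ℚᵘ.mkℚᵘ b 0        ≃⟨ ℚᵘP.+-cong (toℚᵘ-ι a) (toℚᵘ-ι b) ⟨
  ℚ.toℚᵘ (ι a) ℚᵘ.+ ℚ.toℚᵘ (ι b)      ≃⟨ ℚP.toℚᵘ-homo-+ (ι a) (ι b) ⟨
  ℚ.toℚᵘ (ι a ℚ.+ ι b)                ∎)
  where
  open ℚᵘP.≤-Reasoning
  times-one : ∀ a b → (a ℤ.+ b) ℤ.* + 1 ≡ (a ℤ.* + 1 ℤ.+ b ℤ.* + 1) ℤ.* + 1
  times-one = solve-∀

ι-homo-* : ∀ a b → ι (a ℤ.* b) ≡ ι a ℚ.* ι b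
ι-homo-* a b = ℚP.toℚᵘ-injective (begin-equality
  ℚ.toℚᵘ (ι (a ℤ.* b))                ≃⟨ toℚᵘ-ι (a ℤ.* b) ⟩
  ℚᵘ.mkℚᵘ (a ℤ.* b) 0                 ≃⟨ ℚᵘ.*≡* refl ⟩
  ℚᵘ.mkℚᵘ a 0 ℚᵘ.* ℚᵘ.mkℚᵘ b 0        ≃⟨ ℚᵘP.*-cong (toℚᵘ-ι a) (toℚᵘ-ι b) ⟨
  ℚ.toℚᵘ (ι a) ℚᵘ.* ℚ.toℚᵘ (ι b)      ≃⟨ ℚP.toℚᵘ-homo-* (ι a) (ι b) ⟨
  ℚ.toℚᵘ (ι a ℚ.* ι b)                ∎)
  where open ℚᵘP.≤-Reasoning

ι-homo‿- : ∀ a → ι (ℤ.- a) ≡ ℚ.- ι a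
ι-homo‿- a = ℚP.toℚᵘ-injective (begin-equality
  ℚ.toℚᵘ (ι (ℤ.- a))                  ≃⟨ toℚᵘ-ι (ℤ.- a) ⟩
  ℚᵘ.mkℚᵘ (ℤ.- a) 0                   ≃⟨ ℚᵘ.*≡* refl ⟩
  ℚᵘ.- ℚᵘ.mkℚᵘ a 0                    ≃⟨ ℚᵘP.-‿cong (toℚᵘ-ι a) ⟨
  ℚᵘ.- ℚ.toℚᵘ (ι a)                   ≃⟨ ℚP.toℚᵘ-homo‿- (ι a) ⟨
  ℚ.toℚᵘ (ℚ.- ι a)                    ∎)
  where open ℚᵘP.≤-Reasoning

ι-homo-sub : ∀ a b → ι (a ℤ.- b) ≡ ι a ℚ.- ι b
ι-homo-sub a b = trans (ι-homo-+ a (ℤ.- b)) (cong (ι a ℚ.+_) (ι-homo‿- b))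

ι-mono-< : ∀ {a b} → a ℤ.< b → ι a ℚ.< ι b
ι-mono-< {a} {b} a<b = ℚP.toℚᵘ-cancel-<
  (ℚᵘP.<-respˡ-≃ (ℚᵘP.≃-sym (toℚᵘ-ι a)) (ℚᵘP.<-respʳ-≃ (ℚᵘP.≃-sym (toℚᵘ-ι b))
    (ℚᵘ.*<* (subst₂ ℤ._<_ (sym (ℤP.*-identityʳ a)) (sym (ℤP.*-identityʳ b)) a<b))))

ι-cancel-< : ∀ {a b} → ι a ℚ.< ι b → a ℤ.< b
ι-cancel-< {a} {b} ιa<ιb
  with ℚᵘP.<-respˡ-≃ (toℚᵘ-ι a) (ℚᵘP.<-respʳ-≃ (toℚᵘ-ι b) (ℚP.toℚᵘ-mono-< ιa<ιb))
... | ℚᵘ.*<* a1<b1 = subst₂ ℤ._<_ (ℤP.*-identityʳ a) (ℤP.*-identityʳ b) a1<b1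

ι-injective : ∀ {a b} → ι a ≡ ι b → a ≡ b
ι-injective {a} {b} ιa≡ιb
  with ℚᵘP.≃-trans (ℚᵘP.≃-sym (toℚᵘ-ι a)) (ℚᵘP.≃-trans (ℚP.toℚᵘ-cong ιa≡ιb) (toℚᵘ-ι b))
... | ℚᵘ.*≡* a1≡b1 = trans (sym (ℤP.*-identityʳ a)) (trans a1≡b1 (ℤP.*-identityʳ b))

ℚ-double-injective : ∀ {a b : ℚ.ℚ} → a ℚ.+ a ≡ b ℚ.+ b → a ≡ b
ℚ-double-injective {a} {b} a+a≡b+b = trans (double a) (trans (cong (ℚ._* ½) a+a≡b+b) (sym (double b)))
  where
  ½ : ℚ.ℚ
  ½ = + 1 ℚ./ 2
  double : ∀ a → a ≡ (a ℚ.+ a) ℚ.* ½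
  double = RingSolver.solve-∀ ℚ-ring

ℤ-double-injective : ∀ {a b} → a ℤ.+ a ≡ b ℤ.+ b → a ≡ b
ℤ-double-injective {a} {b} a+a≡b+b =
  ℤP.*-cancelˡ-≡ (+ 2) a b (trans (twice a) (trans a+a≡b+b (sym (twice b))))
  where
  twice : ∀ x → + 2 ℤ.* x ≡ x ℤ.+ x
  twice = solve-∀

sub-positive : ∀ {a b} → a ℤ.< b → + 0 ℤ.< b ℤ.- a
sub-positive {a} {b} a<b = subst (ℤ._< b ℤ.- a) (ℤP.+-inverseʳ a) (ℤP.+-monoˡ-< (ℤ.- a) a<b)

<+1⇒≤ : ∀ {a b} → a ℤ.< b ℤ.+ + 1 → a ℤ.≤ b
<+1⇒≤ {a} {b} a<b+1 =
  subst (a ℤ.≤_) (trans (cong ℤ.pred (ℤP.+-comm b (+ 1))) (ℤP.pred-suc b)) (ℤP.i<j⇒i≤pred[j] a<b+1)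

sum-const : ∀ n c → sum {n} (λ _ → c) ≡ + n ℤ.* c
sum-const ℕ.zero    c = sym (ℤP.*-zeroˡ c)
sum-const (suc n) c = trans (cong (ℤ._+_ c) (sum-const n c)) (sym (ℤP.suc-* (+ n) c))

sum-neg : ∀ {n} (f : Fin n → ℤ) → sum (λ i → ℤ.- f i) ≡ ℤ.- sum f
sum-neg {ℕ.zero}  f = refl
sum-neg {suc n} f = trans (cong (ℤ._+_ (ℤ.- f Fin.zero)) (sum-neg (f ∘ Fin.suc)))
                          (sym (ℤP.neg-distrib-+ (f Fin.zero) (sum (f ∘ Fin.suc))))

sum-sub : ∀ {n} (f g : Fin n → ℤ) → sum (λ i → f i ℤ.- g i) ≡ sum f ℤ.- sum g
sum-sub f g = trans (∑-distrib-+ f (λ i → ℤ.- g i)) (cong (ℤ._+_ (sum f)) (sum-neg g))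

sum-mono-≤ : ∀ {n} {f g : Fin n → ℤ} → (∀ i → f i ℤ.≤ g i) → sum f ℤ.≤ sum g
sum-mono-≤ {ℕ.zero}  f≤g = ℤP.≤-refl
sum-mono-≤ {suc n} f≤g = ℤP.+-mono-≤ (f≤g Fin.zero) (sum-mono-≤ (f≤g ∘ Fin.suc))

sum-mono-< : ∀ {n} {f g : Fin n → ℤ} → (∀ i → f i ℤ.≤ g i) → ∀ k → f k ℤ.< g k → sum f ℤ.< sum g
sum-mono-< f≤g Fin.zero    fk<gk = ℤP.+-mono-<-≤ fk<gk (sum-mono-≤ (f≤g ∘ Fin.suc))
sum-mono-< f≤g (Fin.suc k) fk<gk = ℤP.+-mono-≤-< (f≤g Fin.zero) (sum-mono-< (f≤g ∘ Fin.suc) k fk<gk)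

sum-except : ∀ {n} (f : Fin n → ℤ) i c → (∀ j → j ≢ i → f j ≡ c) → sum f ℤ.+ c ≡ f i ℤ.+ + n ℤ.* c
sum-except {suc n} f i c f≡c = begin
  sum f ℤ.+ c                                   ≡⟨ cong (ℤ._+ c) (sum-remove {i = i} f) ⟩
  f i ℤ.+ sum (Vec.removeAt f i) ℤ.+ c          ≡⟨ cong (λ s → f i ℤ.+ s ℤ.+ c) rest ⟩
  f i ℤ.+ + n ℤ.* c ℤ.+ c                       ≡⟨ regroup (f i) (+ n) c ⟩
  f i ℤ.+ (+ 1 ℤ.+ + n) ℤ.* c                   ∎
  where
  open ≡-Reasoning
  rest : sum (Vec.removeAt f i) ≡ + n ℤ.* c
  rest = trans (sum-cong-≗ (λ k → f≡c (Fin.punchIn i k) (FinP.punchInᵢ≢i i k))) (sum-const n c)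
  regroup : ∀ a m c → a ℤ.+ m ℤ.* c ℤ.+ c ≡ a ℤ.+ (+ 1 ℤ.+ m) ℤ.* c
  regroup = solve-∀

sum-toℕ : ∀ n → sum {n} (λ i → + toℕ i) ℤ.+ sum {n} (λ i → + toℕ i) ≡ + n ℤ.* (+ n ℤ.- + 1)
sum-toℕ ℕ.zero    = refl
sum-toℕ (suc n) = begin
  S′ ℤ.+ S′                                    ≡⟨ cong₂ ℤ._+_ S′≡ S′≡ ⟩
  (+ n ℤ.* + 1 ℤ.+ S) ℤ.+ (+ n ℤ.* + 1 ℤ.+ S)  ≡⟨ regroup (+ n) S S ⟩
  + n ℤ.+ + n ℤ.+ (S ℤ.+ S)                    ≡⟨ cong (ℤ._+_ (+ n ℤ.+ + n)) (sum-toℕ n) ⟩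
  + n ℤ.+ + n ℤ.+ + n ℤ.* (+ n ℤ.- + 1)        ≡⟨ gauss-step (+ n) ⟩
  + suc n ℤ.* (+ suc n ℤ.- + 1)                ∎
  where
  open ≡-Reasoning
  S S′ : ℤ
  S  = sum {n} (λ i → + toℕ i)
  S′ = sum {suc n} (λ i → + toℕ i)
  S′≡ : S′ ≡ + n ℤ.* + 1 ℤ.+ S
  S′≡ = trans (ℤP.+-identityˡ _) (trans (∑-distrib-+ {n} (λ _ → + 1) (λ i → + toℕ i))
                                        (cong (ℤ._+ S) (sum-const n (+ 1))))
  regroup : ∀ a s t → (a ℤ.* + 1 ℤ.+ s) ℤ.+ (a ℤ.* + 1 ℤ.+ t) ≡ a ℤ.+ a ℤ.+ (s ℤ.+ t)
  regroup = solve-∀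
  gauss-step : ∀ a → a ℤ.+ a ℤ.+ a ℤ.* (a ℤ.- + 1) ≡ (+ 1 ℤ.+ a) ℤ.* ((+ 1 ℤ.+ a) ℤ.- + 1)
  gauss-step = solve-∀

injective⇒surjective : ∀ {n} (f : Fin n → Fin n) → Injective _≡_ _≡_ f → ∀ t → ∃ λ j → f j ≡ t
injective⇒surjective {suc n} f f-inj t with FinP.any? (λ j → f j FinP.≟ t)
... | yes hit = hit
... | no miss = ⊥-elim (ℕP.<-irrefl refl (FinP.injective⇒≤ punched-injective))
  where
  f≢t : ∀ j → t ≢ f j
  f≢t j t≡fj = miss (j , sym t≡fj)
  punched-injective : Injective _≡_ _≡_ (λ j → Fin.punchOut (f≢t j))
  punched-injective eq = f-inj (FinP.punchOut-injective (f≢t _) (f≢t _) eq)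

sum-toℕ-injective : ∀ {n} (f : Fin n → Fin n) → Injective _≡_ _≡_ f →
                    sum (λ j → + toℕ (f j)) ≡ sum {n} (λ j → + toℕ j)
sum-toℕ-injective {n} f f-inj = sym (sum-permute (λ j → + toℕ j) (permutation f f⁻¹ f∘f⁻¹ f⁻¹∘f))
  where
  f⁻¹ : Fin n → Fin n
  f⁻¹ t = proj₁ (injective⇒surjective f f-inj t)
  f∘f⁻¹ : ∀ t → f (f⁻¹ t) ≡ t
  f∘f⁻¹ t = proj₂ (injective⇒surjective f f-inj t)
  f⁻¹∘f : ∀ j → f⁻¹ (f j) ≡ j
  f⁻¹∘f j = f-inj (f∘f⁻¹ (f j))

sum-injective-range : ∀ {n} (f : Fin n → ℤ) → (∀ j → + 0 ℤ.≤ f j × f j ℤ.< + n) →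
                      Injective _≡_ _≡_ f → sum f ≡ sum {n} (λ j → + toℕ j)
sum-injective-range {n} f range f-inj = begin
  sum f                         ≡⟨ sum-cong-≗ (λ j → sym (toℕ-toFin (range j))) ⟩
  sum (λ j → + toℕ (f′ j))      ≡⟨ sum-toℕ-injective f′ f′-injective ⟩
  sum {n} (λ j → + toℕ j)       ∎
  where
  open ≡-Reasoning
  toFin : ∀ {z} → + 0 ℤ.≤ z × z ℤ.< + n → Fin n
  toFin {+ k} (_ , ℤ.+<+ k<n) = Fin.fromℕ< k<n
  toℕ-toFin : ∀ {z} (p : + 0 ℤ.≤ z × z ℤ.< + n) → + toℕ (toFin p) ≡ z
  toℕ-toFin {+ k} (_ , ℤ.+<+ k<n) = cong +_ (FinP.toℕ-fromℕ< k<n)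
  f′ : Fin n → Fin n
  f′ j = toFin (range j)
  f′-injective : Injective _≡_ _≡_ f′
  f′-injective {a} {b} eq =
    f-inj (trans (sym (toℕ-toFin (range a))) (trans (cong (+_ ∘ toℕ) eq) (toℕ-toFin (range b))))

-- Windows

BetweenMultiples : ℕ → ℤ → ℤ → Set
BetweenMultiples n k d = (+ n ℤ.* k ℤ.< d) × (d ℤ.< + n ℤ.* k ℤ.+ + n)

between⇒residue : ∀ {n k d} → BetweenMultiples n k d →
                  (+ 0 ℤ.< d ℤ.- + n ℤ.* k) × (d ℤ.- + n ℤ.* k ℤ.< + n)
between⇒residue {n} {k} {d} (nk<d , d<nk+n) =
  subst (ℤ._< d ℤ.- + n ℤ.* k) (ℤP.+-inverseʳ (+ n ℤ.* k)) (ℤP.+-monoˡ-< (ℤ.- (+ n ℤ.* k)) nk<d) ,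
  subst (d ℤ.- + n ℤ.* k ℤ.<_) (cancel (+ n ℤ.* k) (+ n)) (ℤP.+-monoˡ-< (ℤ.- (+ n ℤ.* k)) d<nk+n)
  where
  cancel : ∀ a b → a ℤ.+ b ℤ.- a ≡ b
  cancel = solve-∀

residue⇒between : ∀ {n k r} → + 0 ℤ.< r → r ℤ.< + n → BetweenMultiples n k (+ n ℤ.* k ℤ.+ r)
residue⇒between {n} {k} 0<r r<n =
  subst (ℤ._< + n ℤ.* k ℤ.+ _) (ℤP.+-identityʳ (+ n ℤ.* k)) (ℤP.+-monoʳ-< (+ n ℤ.* k) 0<r) ,
  ℤP.+-monoʳ-< (+ n ℤ.* k) r<n

between-neg : ∀ {n k d} → BetweenMultiples n k d → BetweenMultiples n (ℤ.- k ℤ.- + 1) (ℤ.- d)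
between-neg {n} {k} {d} (nk<d , d<nk+n) =
  subst (ℤ._< ℤ.- d) (flip-upper (+ n) k) (ℤP.neg-mono-< d<nk+n) ,
  subst (ℤ.- d ℤ.<_) (flip-lower (+ n) k) (ℤP.neg-mono-< nk<d)
  where
  flip-upper : ∀ a k → ℤ.- (a ℤ.* k ℤ.+ a) ≡ a ℤ.* (ℤ.- k ℤ.- + 1)
  flip-upper = solve-∀
  flip-lower : ∀ a k → ℤ.- (a ℤ.* k) ≡ a ℤ.* (ℤ.- k ℤ.- + 1) ℤ.+ a
  flip-lower = solve-∀

multiple-not-between : ∀ n k c → ¬ BetweenMultiples n k (+ n ℤ.* c)
multiple-not-between n k c (nk<nc , nc<nk+n) = ℤP.<-irrefl refl (ℤP.<-≤-trans nc<nk+n nk+n≤nc)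
  where
  distrib : ∀ a k → a ℤ.* (+ 1 ℤ.+ k) ≡ a ℤ.* k ℤ.+ a
  distrib = solve-∀
  nk+n≤nc : + n ℤ.* k ℤ.+ + n ℤ.≤ + n ℤ.* c
  nk+n≤nc = subst (ℤ._≤ + n ℤ.* c) (distrib (+ n) k)
    (ℤP.*-monoˡ-≤-nonNeg (+ n) (ℤP.i<j⇒suc[i]≤j (ℤP.*-cancelˡ-<-nonNeg (+ n) nk<nc)))

difference-between : ∀ {n a b} → a ℕ.< b → b ℕ.< n → BetweenMultiples n (+ 0) (+ b ℤ.- + a)
difference-between {n} {a} {b} a<b b<n =
  subst (BetweenMultiples n (+ 0)) n*0+d≡d (residue⇒between (sub-positive (ℤ.+<+ a<b)) d<n)
  where
  d<n : + b ℤ.- + a ℤ.< + n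
  d<n = ℤP.≤-<-trans (ℤP.i-j≤i (+ b) (+ a)) (ℤ.+<+ b<n)
  n*0+d≡d : + n ℤ.* + 0 ℤ.+ (+ b ℤ.- + a) ≡ + b ℤ.- + a
  n*0+d≡d = trans (cong (ℤ._+ (+ b ℤ.- + a)) (ℤP.*-zeroʳ (+ n))) (ℤP.+-identityˡ (+ b ℤ.- + a))

FloorCocycle : ∀ {n} → (Fin n → Fin n → ℤ) → Set
FloorCocycle K = ∀ i j l → (K i j ℤ.+ K j l ℤ.≤ K i l) × (K i l ℤ.≤ K i j ℤ.+ K j l ℤ.+ + 1)

window : ∀ {n} → (Fin n → Fin n → ℤ) → Fin n → ℤ
window K i = + 1 ℤ.- sum (K i)

module _ {n} (K : Fin n → Fin n → ℤ) where

  window-difference : ∀ i j →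
                      window K j ℤ.- window K i ≡ + n ℤ.* K i j ℤ.+ sum (λ l → K i l ℤ.- K j l ℤ.- K i j)
  window-difference i j = begin
    (+ 1 ℤ.- sum (K j)) ℤ.- (+ 1 ℤ.- sum (K i))
      ≡⟨ swap (sum (K i)) (sum (K j)) ⟩
    sum (K i) ℤ.- sum (K j)
      ≡⟨ sum-sub (K i) (K j) ⟨
    sum (λ l → K i l ℤ.- K j l)
      ≡⟨ sum-cong-≗ (λ l → split (K i l) (K j l) (K i j)) ⟩
    sum (λ l → K i j ℤ.+ (K i l ℤ.- K j l ℤ.- K i j))
      ≡⟨ ∑-distrib-+ (λ _ → K i j) (λ l → K i l ℤ.- K j l ℤ.- K i j) ⟩
    sum {n} (λ _ → K i j) ℤ.+ sum (λ l → K i l ℤ.- K j l ℤ.- K i j)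
      ≡⟨ cong (ℤ._+ sum (λ l → K i l ℤ.- K j l ℤ.- K i j)) (sum-const n (K i j)) ⟩
    + n ℤ.* K i j ℤ.+ sum (λ l → K i l ℤ.- K j l ℤ.- K i j) ∎
    where
    open ≡-Reasoning
    swap : ∀ a b → (+ 1 ℤ.- b) ℤ.- (+ 1 ℤ.- a) ≡ a ℤ.- b
    swap = solve-∀
    split : ∀ a b c → a ℤ.- b ≡ c ℤ.+ (a ℤ.- b ℤ.- c)
    split = solve-∀

  cocycle-defect : FloorCocycle K → ∀ i j l →
                   (+ 0 ℤ.≤ K i l ℤ.- K j l ℤ.- K i j) × (K i l ℤ.- K j l ℤ.- K i j ℤ.≤ + 1)
  cocycle-defect cocycle i j l =
    subst (+ 0 ℤ.≤_) (lower (K i j) (K j l) (K i l)) (ℤP.i≤j⇒0≤j-i (proj₁ (cocycle i j l))) ,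
    ℤP.0≤i-j⇒j≤i (subst (+ 0 ℤ.≤_) (upper (K i j) (K j l) (K i l)) (ℤP.i≤j⇒0≤j-i (proj₂ (cocycle i j l))))
    where
    lower : ∀ a b c → c ℤ.- (a ℤ.+ b) ≡ c ℤ.- b ℤ.- a
    lower = solve-∀
    upper : ∀ a b c → a ℤ.+ b ℤ.+ + 1 ℤ.- c ≡ + 1 ℤ.- (c ℤ.- b ℤ.- a)
    upper = solve-∀

  module _ (diagonal : ∀ i → K i i ≡ + 0)
           (antisymmetric : ∀ i j → i ≢ j → K i j ℤ.+ K j i ≡ ℤ.- + 1) where

    window-between : FloorCocycle K → ∀ i j → i ≢ j → BetweenMultiples n (K i j) (window K j ℤ.- window K i)
    window-between cocycle i j i≢j =
      subst (BetweenMultiples n (K i j)) (sym (window-difference i j)) (residue⇒between Σε>0 Σε<n)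
      where
      ε : Fin n → ℤ
      ε l = K i l ℤ.- K j l ℤ.- K i j
      εi≡1 : ε i ≡ + 1
      εi≡1 = begin
        K i i ℤ.- K j i ℤ.- K i j        ≡⟨ cong (λ d → d ℤ.- K j i ℤ.- K i j) (diagonal i) ⟩
        + 0 ℤ.- K j i ℤ.- K i j          ≡⟨ negate-sum (K i j) (K j i) ⟩
        ℤ.- (K i j ℤ.+ K j i)            ≡⟨ cong ℤ.-_ (antisymmetric i j i≢j) ⟩
        + 1                              ∎
        where
        open ≡-Reasoning
        negate-sum : ∀ a b → + 0 ℤ.- b ℤ.- a ≡ ℤ.- (a ℤ.+ b)
        negate-sum = solve-∀
      εj≡0 : ε j ≡ + 0
      εj≡0 = trans (cong (λ d → K i j ℤ.- d ℤ.- K i j) (diagonal j)) (vanish (K i j))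
        where
        vanish : ∀ a → a ℤ.- + 0 ℤ.- a ≡ + 0
        vanish = solve-∀
      Σε>0 : + 0 ℤ.< sum ε
      Σε>0 = subst (ℤ._< sum ε) (trans (sum-const n (+ 0)) (ℤP.*-zeroʳ (+ n)))
        (sum-mono-< (proj₁ ∘ cocycle-defect cocycle i j) i (subst (+ 0 ℤ.<_) (sym εi≡1) (ℤ.+<+ ℕ.z<s)))
      Σε<n : sum ε ℤ.< + n
      Σε<n = subst (sum ε ℤ.<_) (trans (sum-const n (+ 1)) (ℤP.*-identityʳ (+ n)))
        (sum-mono-< (proj₂ ∘ cocycle-defect cocycle i j) j (subst (ℤ._< + 1) (sym εj≡0) (ℤ.+<+ ℕ.z<s)))

    antisymmetric-row-sum : ∀ i → sum (λ j → K i j ℤ.+ K j i) ≡ + 1 ℤ.- + n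
    antisymmetric-row-sum i = begin
      sum h
        ≡⟨ add-sub (sum h) ⟩
      sum h ℤ.+ ℤ.- + 1 ℤ.+ + 1
        ≡⟨ cong (ℤ._+ + 1) (sum-except h i (ℤ.- + 1) off-diagonal) ⟩
      h i ℤ.+ + n ℤ.* ℤ.- + 1 ℤ.+ + 1
        ≡⟨ cong (λ d → d ℤ.+ d ℤ.+ + n ℤ.* ℤ.- + 1 ℤ.+ + 1) (diagonal i) ⟩
      + 0 ℤ.+ + 0 ℤ.+ + n ℤ.* ℤ.- + 1 ℤ.+ + 1
        ≡⟨ simplify (+ n) ⟩
      + 1 ℤ.- + n ∎
      where
      open ≡-Reasoning
      h : Fin n → ℤ
      h j = K i j ℤ.+ K j i
      off-diagonal : ∀ j → j ≢ i → h j ≡ ℤ.- + 1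
      off-diagonal j j≢i = antisymmetric i j (j≢i ∘ sym)
      add-sub : ∀ a → a ≡ a ℤ.+ ℤ.- + 1 ℤ.+ + 1
      add-sub = solve-∀
      simplify : ∀ m → + 0 ℤ.+ + 0 ℤ.+ m ℤ.* ℤ.- + 1 ℤ.+ + 1 ≡ + 1 ℤ.- m
      simplify = solve-∀

    window-sum : sum (window K) ℤ.+ sum (window K) ≡ + n ℤ.* + suc n
    window-sum = begin
      sum (window K) ℤ.+ sum (window K)                 ≡⟨ cong₂ ℤ._+_ Σwindow Σwindow ⟩
      (+ n ℤ.* + 1 ℤ.- S) ℤ.+ (+ n ℤ.* + 1 ℤ.- S)       ≡⟨ regroup (+ n) S ⟩
      + n ℤ.+ + n ℤ.- (S ℤ.+ S)                         ≡⟨ cong (λ t → + n ℤ.+ + n ℤ.- t) S+S ⟩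
      + n ℤ.+ + n ℤ.- + n ℤ.* (+ 1 ℤ.- + n)             ≡⟨ finish (+ n) ⟩
      + n ℤ.* (+ 1 ℤ.+ + n)                             ∎
      where
      open ≡-Reasoning
      S : ℤ
      S = sum (λ i → sum (K i))
      Σwindow : sum (window K) ≡ + n ℤ.* + 1 ℤ.- S
      Σwindow = trans (sum-sub (λ _ → + 1) (λ i → sum (K i))) (cong (ℤ._- S) (sum-const n (+ 1)))
      S+S : S ℤ.+ S ≡ + n ℤ.* (+ 1 ℤ.- + n)
      S+S = begin
        S ℤ.+ S
          ≡⟨ cong (ℤ._+_ S) (∑-comm K) ⟩
        S ℤ.+ sum (λ i → sum (λ j → K j i))
          ≡⟨ ∑-distrib-+ (λ i → sum (K i)) (λ i → sum (λ j → K j i)) ⟨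
        sum (λ i → sum (K i) ℤ.+ sum (λ j → K j i))
          ≡⟨ sum-cong-≗ (λ i → sym (∑-distrib-+ (K i) (λ j → K j i))) ⟩
        sum (λ i → sum (λ j → K i j ℤ.+ K j i))
          ≡⟨ sum-cong-≗ antisymmetric-row-sum ⟩
        sum {n} (λ _ → + 1 ℤ.- + n)
          ≡⟨ sum-const n (+ 1 ℤ.- + n) ⟩
        + n ℤ.* (+ 1 ℤ.- + n) ∎
      regroup : ∀ m s → (m ℤ.* + 1 ℤ.- s) ℤ.+ (m ℤ.* + 1 ℤ.- s) ≡ m ℤ.+ m ℤ.- (s ℤ.+ s)
      regroup = solve-∀
      finish : ∀ m → m ℤ.+ m ℤ.- m ℤ.* (+ 1 ℤ.- m) ≡ m ℤ.* (+ 1 ℤ.+ m)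
      finish = solve-∀

  module _ (diagonal : ∀ i → K i i ≡ + 0) (m : Fin n → ℤ)
           (between : ∀ i j → i ≢ j → BetweenMultiples n (K i j) (m j ℤ.- m i)) where

    residue-sum : ∀ i → sum m ℤ.- + n ℤ.* m i ℤ.- + n ℤ.* sum (K i) ≡ sum {n} (λ j → + toℕ j)
    residue-sum i = trans (sym Σρ) (sum-injective-range ρ ρ-range ρ-injective)
      where
      ρ : Fin n → ℤ
      ρ j = m j ℤ.- m i ℤ.- + n ℤ.* K i j
      ρ-range : ∀ j → + 0 ℤ.≤ ρ j × ρ j ℤ.< + n
      ρ-range j with j FinP.≟ i
      ... | yes refl =
        ℤP.≤-reflexive (sym ρi≡0) , subst (ℤ._< + n) (sym ρi≡0) (ℤ.+<+ (ℕP.≤-<-trans ℕ.z≤n (FinP.toℕ<n i)))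
        where
        vanish : ∀ a b → a ℤ.- a ℤ.- b ℤ.* + 0 ≡ + 0
        vanish = solve-∀
        ρi≡0 : ρ i ≡ + 0
        ρi≡0 = trans (cong (λ d → m i ℤ.- m i ℤ.- + n ℤ.* d) (diagonal i)) (vanish (m i) (+ n))
      ... | no j≢i = let (0<ρj , ρj<n) = between⇒residue (between i j (j≢i ∘ sym)) in ℤP.<⇒≤ 0<ρj , ρj<n
      ρ-injective : Injective _≡_ _≡_ ρ
      ρ-injective {a} {b} ρa≡ρb with a FinP.≟ b
      ... | yes a≡b = a≡b
      ... | no a≢b  = ⊥-elim (multiple-not-between n (K b a) (K i a ℤ.- K i b)
                        (subst (BetweenMultiples n (K b a)) difference (between b a (a≢b ∘ sym))))
        where
        expand : ∀ ma mb mi c ka kb →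
                 ma ℤ.- mb ≡ (ma ℤ.- mi ℤ.- c ℤ.* ka) ℤ.- (mb ℤ.- mi ℤ.- c ℤ.* kb) ℤ.+ c ℤ.* (ka ℤ.- kb)
        expand = solve-∀
        cancel : ∀ r t → r ℤ.- r ℤ.+ t ≡ t
        cancel = solve-∀
        difference : m a ℤ.- m b ≡ + n ℤ.* (K i a ℤ.- K i b)
        difference = trans (expand (m a) (m b) (m i) (+ n) (K i a) (K i b))
          (trans (cong (λ r → r ℤ.- ρ b ℤ.+ + n ℤ.* (K i a ℤ.- K i b)) ρa≡ρb)
                 (cancel (ρ b) (+ n ℤ.* (K i a ℤ.- K i b))))
      Σρ : sum ρ ≡ sum m ℤ.- + n ℤ.* m i ℤ.- + n ℤ.* sum (K i)
      Σρ = begin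
        sum ρ
          ≡⟨ sum-sub (λ j → m j ℤ.- m i) (λ j → + n ℤ.* K i j) ⟩
        sum (λ j → m j ℤ.- m i) ℤ.- sum (λ j → + n ℤ.* K i j)
          ≡⟨ cong₂ ℤ._-_ (sum-sub m (λ _ → m i)) (sym (*-distribˡ-sum (+ n) (K i))) ⟩
        sum m ℤ.- sum {n} (λ _ → m i) ℤ.- + n ℤ.* sum (K i)
          ≡⟨ cong (λ t → sum m ℤ.- t ℤ.- + n ℤ.* sum (K i)) (sum-const n (m i)) ⟩
        sum m ℤ.- + n ℤ.* m i ℤ.- + n ℤ.* sum (K i) ∎
        where open ≡-Reasoning

    window-unique : sum m ℤ.+ sum m ≡ + n ℤ.* + suc n → ∀ i → m i ≡ window K i
    window-unique Σm i = ℤ-double-injective (ℤP.*-cancelˡ-≡ (+ n) _ _ (begin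
      + n ℤ.* (m i ℤ.+ m i)
        ≡⟨ expand (sum m) (m i) Q (+ n) ⟩
      (sum m ℤ.+ sum m) ℤ.- (R ℤ.+ R) ℤ.- + n ℤ.* (Q ℤ.+ Q)
        ≡⟨ cong₂ (λ s r → s ℤ.- (r ℤ.+ r) ℤ.- + n ℤ.* (Q ℤ.+ Q)) Σm (residue-sum i) ⟩
      + n ℤ.* + suc n ℤ.- (T ℤ.+ T) ℤ.- + n ℤ.* (Q ℤ.+ Q)
        ≡⟨ cong (λ t → + n ℤ.* + suc n ℤ.- t ℤ.- + n ℤ.* (Q ℤ.+ Q)) (sum-toℕ n) ⟩
      + n ℤ.* + suc n ℤ.- + n ℤ.* (+ n ℤ.- + 1) ℤ.- + n ℤ.* (Q ℤ.+ Q)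
        ≡⟨ collect (+ n) Q ⟩
      + n ℤ.* (window K i ℤ.+ window K i) ∎))
      where
      open ≡-Reasoning
      instance
        n≢0 : NonZero n
        n≢0 = ℕ.>-nonZero (ℕP.≤-<-trans ℕ.z≤n (FinP.toℕ<n i))
      Q R T : ℤ
      Q = sum (K i)
      R = sum m ℤ.- + n ℤ.* m i ℤ.- + n ℤ.* Q
      T = sum {n} (λ j → + toℕ j)
      expand : ∀ s mi q c → c ℤ.* (mi ℤ.+ mi) ≡
               (s ℤ.+ s) ℤ.- ((s ℤ.- c ℤ.* mi ℤ.- c ℤ.* q) ℤ.+ (s ℤ.- c ℤ.* mi ℤ.- c ℤ.* q)) ℤ.- c ℤ.* (q ℤ.+ q)
      expand = solve-∀
      collect : ∀ c q → c ℤ.* (+ 1 ℤ.+ c) ℤ.- c ℤ.* (c ℤ.- + 1) ℤ.- c ℤ.* (q ℤ.+ q) ≡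
                        c ℤ.* ((+ 1 ℤ.- q) ℤ.+ (+ 1 ℤ.- q))
      collect = solve-∀

-- Alcoves

-- On the alcove of k this is ⌊x_i − x_j⌋; as x_i − x_j is never an integer there,
-- ⌊x_j − x_i⌋ = −1 − k_ij.
alcoveFloor : ∀ {n} → (Fin n → Fin n → ℤ) → Fin n → Fin n → ℤ
alcoveFloor k i j with FinP.<-cmp i j
... | tri< _ _ _ = k i j
... | tri≈ _ _ _ = + 0
... | tri> _ _ _ = ℤ.- k j i ℤ.- + 1

module _ {n} (k : Fin n → Fin n → ℤ) where

  alcoveFloor-< : ∀ {i j} → toℕ i ℕ.< toℕ j → alcoveFloor k i j ≡ k i j
  alcoveFloor-< {i} {j} i<j with FinP.<-cmp i j
  ... | tri< _ _ _   = refl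
  ... | tri≈ _ i≡j _ = ⊥-elim (FinP.<-irrefl i≡j i<j)
  ... | tri> _ _ j<i = ⊥-elim (FinP.<-asym i<j j<i)

  alcoveFloor-> : ∀ {i j} → toℕ j ℕ.< toℕ i → alcoveFloor k i j ≡ ℤ.- k j i ℤ.- + 1
  alcoveFloor-> {i} {j} j<i with FinP.<-cmp i j
  ... | tri< i<j _ _ = ⊥-elim (FinP.<-asym i<j j<i)
  ... | tri≈ _ i≡j _ = ⊥-elim (FinP.<-irrefl (sym i≡j) j<i)
  ... | tri> _ _ _   = refl

  alcoveFloor-diagonal : ∀ i → alcoveFloor k i i ≡ + 0
  alcoveFloor-diagonal i with FinP.<-cmp i i
  ... | tri< i<i _ _ = ⊥-elim (FinP.<-irrefl refl i<i)
  ... | tri≈ _ _ _   = refl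
  ... | tri> _ _ i<i = ⊥-elim (FinP.<-irrefl refl i<i)

  alcoveFloor-antisymmetric : ∀ i j → i ≢ j → alcoveFloor k i j ℤ.+ alcoveFloor k j i ≡ ℤ.- + 1
  alcoveFloor-antisymmetric i j i≢j with FinP.<-cmp i j
  ... | tri< i<j _ _ = trans (cong (ℤ._+_ (k i j)) (alcoveFloor-> i<j)) (cancel (k i j))
    where
    cancel : ∀ a → a ℤ.+ (ℤ.- a ℤ.- + 1) ≡ ℤ.- + 1
    cancel = solve-∀
  ... | tri≈ _ i≡j _ = ⊥-elim (i≢j i≡j)
  ... | tri> _ _ j<i = trans (cong (ℤ._+_ (ℤ.- k j i ℤ.- + 1)) (alcoveFloor-< j<i)) (cancel (k j i))
    where
    cancel : ∀ a → ℤ.- a ℤ.- + 1 ℤ.+ a ≡ ℤ.- + 1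
    cancel = solve-∀

floor-neg : ∀ {a p} → ι a ℚ.< p → p ℚ.< ι (a ℤ.+ + 1) →
            ι (ℤ.- a ℤ.- + 1) ℚ.< ℚ.- p × ℚ.- p ℚ.< ι (ℤ.- a ℤ.- + 1 ℤ.+ + 1)
floor-neg {a} {p} a<p p<a+1 =
  subst (ℚ._< ℚ.- p) (trans (sym (ι-homo‿- (a ℤ.+ + 1))) (cong ι (negate a))) (ℚP.neg-antimono-< p<a+1) ,
  subst (ℚ.- p ℚ.<_) (trans (sym (ι-homo‿- a)) (cong ι (negate-succ a))) (ℚP.neg-antimono-< a<p)
  where
  negate : ∀ a → ℤ.- (a ℤ.+ + 1) ≡ ℤ.- a ℤ.- + 1
  negate = solve-∀
  negate-succ : ∀ a → ℤ.- a ≡ ℤ.- a ℤ.- + 1 ℤ.+ + 1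
  negate-succ = solve-∀

floor-add : ∀ {a b c p q} →
            ι a ℚ.≤ p → p ℚ.< ι (a ℤ.+ + 1) → ι b ℚ.≤ q → q ℚ.< ι (b ℤ.+ + 1) →
            ι c ℚ.≤ p ℚ.+ q → p ℚ.+ q ℚ.< ι (c ℤ.+ + 1) →
            (a ℤ.+ b ℤ.≤ c) × (c ℤ.≤ a ℤ.+ b ℤ.+ + 1)
floor-add {a} {b} {c} {p} {q} a≤p p<a+1 b≤q q<b+1 c≤p+q p+q<c+1 =
  <+1⇒≤ (ι-cancel-< (ℚP.≤-<-trans ιa+ιb≤p+q p+q<c+1)) ,
  <+1⇒≤ (ι-cancel-< (subst (ι c ℚ.<_) p+q-bound (ℚP.≤-<-trans c≤p+q (ℚP.+-mono-< p<a+1 q<b+1))))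
  where
  ιa+ιb≤p+q : ι (a ℤ.+ b) ℚ.≤ p ℚ.+ q
  ιa+ιb≤p+q = subst (ℚ._≤ p ℚ.+ q) (sym (ι-homo-+ a b)) (ℚP.+-mono-≤ a≤p b≤q)
  regroup : ∀ a b → (a ℤ.+ + 1) ℤ.+ (b ℤ.+ + 1) ≡ a ℤ.+ b ℤ.+ + 1 ℤ.+ + 1
  regroup = solve-∀
  p+q-bound : ι (a ℤ.+ + 1) ℚ.+ ι (b ℤ.+ + 1) ≡ ι (a ℤ.+ b ℤ.+ + 1 ℤ.+ + 1)
  p+q-bound = trans (sym (ι-homo-+ (a ℤ.+ + 1) (b ℤ.+ + 1))) (cong ι (regroup a b))

module _ {n} {k : Fin n → Fin n → ℤ} {z : Point n} (z∈A : InAlcove k z) where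

  InAlcove⇒floor : ∀ i j → i ≢ j →
    ι (alcoveFloor k i j) ℚ.< z i ℚ.- z j × z i ℚ.- z j ℚ.< ι (alcoveFloor k i j ℤ.+ + 1)
  InAlcove⇒floor i j i≢j with FinP.<-cmp i j
  ... | tri< i<j _ _ = z∈A i j i<j
  ... | tri≈ _ i≡j _ = ⊥-elim (i≢j i≡j)
  ... | tri> _ _ j<i = let (lower , upper) = floor-neg {k j i} (proj₁ (z∈A j i j<i)) (proj₂ (z∈A j i j<i)) in
                       subst (ι (ℤ.- k j i ℤ.- + 1) ℚ.<_) (negate (z j) (z i)) lower ,
                       subst (ℚ._< ι (ℤ.- k j i ℤ.- + 1 ℤ.+ + 1)) (negate (z j) (z i)) upper
    where
    negate : ∀ a b → ℚ.- (a ℚ.- b) ≡ b ℚ.- a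
    negate = RingSolver.solve-∀ ℚ-ring

  private
    floor-≤ : ∀ i j →
      ι (alcoveFloor k i j) ℚ.≤ z i ℚ.- z j × z i ℚ.- z j ℚ.< ι (alcoveFloor k i j ℤ.+ + 1)
    floor-≤ i j with i FinP.≟ j
    ... | no i≢j  = let (lower , upper) = InAlcove⇒floor i j i≢j in ℚP.<⇒≤ lower , upper
    ... | yes refl rewrite alcoveFloor-diagonal k i | ℚP.+-inverseʳ (z i) =
      ℚP.≤-refl , ι-mono-< {+ 0} {+ 1} (ℤ.+<+ ℕ.z<s)

  alcoveFloor-cocycle : FloorCocycle (alcoveFloor k)
  alcoveFloor-cocycle i j l =
    floor-add {alcoveFloor k i j} {alcoveFloor k j l} {alcoveFloor k i l}
              (proj₁ (floor-≤ i j)) (proj₂ (floor-≤ i j)) (proj₁ (floor-≤ j l)) (proj₂ (floor-≤ j l))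
              (subst (ι (alcoveFloor k i l) ℚ.≤_) (telescope (z i) (z j) (z l)) (proj₁ (floor-≤ i l)))
              (subst (ℚ._< ι (alcoveFloor k i l ℤ.+ + 1)) (telescope (z i) (z j) (z l)) (proj₂ (floor-≤ i l)))
    where
    telescope : ∀ a b c → a ℚ.- c ≡ (a ℚ.- b) ℚ.+ (b ℚ.- c)
    telescope = RingSolver.solve-∀ ℚ-ring

-- Integral points

sumℚ-cong : ∀ {n} {f g : Point n} → (∀ i → f i ≡ g i) → sumℚ f ≡ sumℚ g
sumℚ-cong {ℕ.zero}  _   = refl
sumℚ-cong {suc n} f≡g = cong₂ ℚ._+_ (f≡g Fin.zero) (sumℚ-cong (f≡g ∘ Fin.suc))

sumℚ-ι : ∀ {n} (f : Fin n → ℤ) → sumℚ (ι ∘ f) ≡ ι (sum f)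
sumℚ-ι {ℕ.zero}  f = refl
sumℚ-ι {suc n} f = trans (cong (ι (f Fin.zero) ℚ.+_) (sumℚ-ι (f ∘ Fin.suc)))
                         (sym (ι-homo-+ (f Fin.zero) (sum (f ∘ Fin.suc))))

sumℚ-affine : ∀ {n} (c d : ℚ.ℚ) (y : Point n) →
              sumℚ (λ i → c ℚ.- d ℚ.* y i) ≡ ι (+ n) ℚ.* c ℚ.- d ℚ.* sumℚ y
sumℚ-affine {ℕ.zero}  c d y = empty c d
  where
  empty : ∀ c d → ℚ.0ℚ ≡ ℚ.0ℚ ℚ.* c ℚ.- d ℚ.* ℚ.0ℚ
  empty = RingSolver.solve-∀ ℚ-ring
sumℚ-affine {suc n} c d y = begin
  (c ℚ.- d ℚ.* y Fin.zero) ℚ.+ sumℚ (λ i → c ℚ.- d ℚ.* y (Fin.suc i))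
    ≡⟨ cong (c ℚ.- d ℚ.* y Fin.zero ℚ.+_) (sumℚ-affine c d (y ∘ Fin.suc)) ⟩
  (c ℚ.- d ℚ.* y Fin.zero) ℚ.+ (ι (+ n) ℚ.* c ℚ.- d ℚ.* S)
    ≡⟨ regroup c d (y Fin.zero) (ι (+ n)) S ⟩
  (ℚ.1ℚ ℚ.+ ι (+ n)) ℚ.* c ℚ.- d ℚ.* (y Fin.zero ℚ.+ S)
    ≡⟨ cong (λ t → t ℚ.* c ℚ.- d ℚ.* (y Fin.zero ℚ.+ S)) (ι-homo-+ (+ 1) (+ n)) ⟨
  ι (+ suc n) ℚ.* c ℚ.- d ℚ.* (y Fin.zero ℚ.+ S) ∎
  where
  open ≡-Reasoning
  S : ℚ.ℚ
  S = sumℚ (y ∘ Fin.suc)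
  regroup : ∀ c d y₀ m s →
            (c ℚ.- d ℚ.* y₀) ℚ.+ (m ℚ.* c ℚ.- d ℚ.* s) ≡ (ℚ.1ℚ ℚ.+ m) ℚ.* c ℚ.- d ℚ.* (y₀ ℚ.+ s)
  regroup = RingSolver.solve-∀ ℚ-ring

module _ (n : ℕ) .{{_ : NonZero n}} where

  private
    N h : ℚ.ℚ
    N = ι (+ n)
    h = + suc n ℚ./ 2

    instance
      N-positive : ℚ.Positive N
      N-positive = ℚP.normalize-pos n 1
      N-nonNegative : ℚ.NonNegative N
      N-nonNegative = ℚP.pos⇒nonNeg N
      N-nonZero : ℚ.NonZero N
      N-nonZero = ℚP.pos⇒nonZero N

    h+h : h ℚ.+ h ≡ ι (+ suc n)
    h+h = ℚP.toℚᵘ-injective (begin-equality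
      ℚ.toℚᵘ (h ℚ.+ h)                                        ≃⟨ ℚP.toℚᵘ-homo-+ h h ⟩
      ℚ.toℚᵘ h ℚᵘ.+ ℚ.toℚᵘ h                                  ≃⟨ ℚᵘP.+-cong toℚᵘ-h toℚᵘ-h ⟩
      ℚᵘ.mkℚᵘ (+ suc n) 1 ℚᵘ.+ ℚᵘ.mkℚᵘ (+ suc n) 1            ≃⟨ ℚᵘ.*≡* (cross-multiply (+ suc n)) ⟩
      ℚᵘ.mkℚᵘ (+ suc n) 0                                     ≃⟨ toℚᵘ-ι (+ suc n) ⟨
      ℚ.toℚᵘ (ι (+ suc n))                                    ∎)
      where
      open ℚᵘP.≤-Reasoning
      toℚᵘ-h : ℚ.toℚᵘ h ℚᵘ.≃ ℚᵘ.mkℚᵘ (+ suc n) 1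
      toℚᵘ-h = ℚP.toℚᵘ-fromℚᵘ (ℚᵘ.mkℚᵘ (+ suc n) 1)
      cross-multiply : ∀ a → (a ℤ.* + 2 ℤ.+ a ℤ.* + 2) ℤ.* + 1 ≡ a ℤ.* + 4
      cross-multiply = solve-∀

    distrib : ∀ a k → a ℤ.* (k ℤ.+ + 1) ≡ a ℤ.* k ℤ.+ a
    distrib = solve-∀

    N*-injective : ∀ {p q} → N ℚ.* p ≡ N ℚ.* q → p ≡ q
    N*-injective {p} {q} Np≡Nq = begin
      p                         ≡⟨ ℚP.*-identityˡ p ⟨
      ℚ.1ℚ ℚ.* p                ≡⟨ cong (ℚ._* p) (ℚP.*-inverseˡ N) ⟨
      ℚ.1/ N ℚ.* N ℚ.* p        ≡⟨ ℚP.*-assoc (ℚ.1/ N) N p ⟩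
      ℚ.1/ N ℚ.* (N ℚ.* p)      ≡⟨ cong (ℚ.1/ N ℚ.*_) Np≡Nq ⟩
      ℚ.1/ N ℚ.* (N ℚ.* q)      ≡⟨ ℚP.*-assoc (ℚ.1/ N) N q ⟨
      ℚ.1/ N ℚ.* N ℚ.* q        ≡⟨ cong (ℚ._* q) (ℚP.*-inverseˡ N) ⟩
      ℚ.1ℚ ℚ.* q                ≡⟨ ℚP.*-identityˡ q ⟩
      q                         ∎
      where open ≡-Reasoning

  witness-diff : ∀ {x : Point n} {m} → IntegralWitness n x m → ∀ i j → N ℚ.* (x i ℚ.- x j) ≡ ι (m j ℤ.- m i)
  witness-diff {x} {m} iw i j = begin
    N ℚ.* (x i ℚ.- x j)                ≡⟨ difference N h (x i) (x j) ⟩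
    special n x j ℚ.- special n x i    ≡⟨ cong₂ ℚ._-_ (iw j) (iw i) ⟩
    ι (m j) ℚ.- ι (m i)                ≡⟨ ι-homo-sub (m j) (m i) ⟨
    ι (m j ℤ.- m i)                    ∎
    where
    open ≡-Reasoning
    difference : ∀ N h a b → N ℚ.* (a ℚ.- b) ≡ (h ℚ.- N ℚ.* b) ℚ.- (h ℚ.- N ℚ.* a)
    difference = RingSolver.solve-∀ ℚ-ring

  floor⇒between : ∀ {k d e} → N ℚ.* d ≡ ι e → ι k ℚ.< d × d ℚ.< ι (k ℤ.+ + 1) → BetweenMultiples n k e
  floor⇒between {k} {d} {e} Nd≡ιe (k<d , d<k+1) =
    ι-cancel-< (subst₂ ℚ._<_ (sym (ι-homo-* (+ n) k)) Nd≡ιe (ℚP.*-monoʳ-<-pos N k<d)) ,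
    subst (e ℤ.<_) (distrib (+ n) k)
      (ι-cancel-< (subst₂ ℚ._<_ Nd≡ιe (sym (ι-homo-* (+ n) (k ℤ.+ + 1))) (ℚP.*-monoʳ-<-pos N d<k+1)))

  between⇒floor : ∀ {k d e} → N ℚ.* d ≡ ι e → BetweenMultiples n k e → ι k ℚ.< d × d ℚ.< ι (k ℤ.+ + 1)
  between⇒floor {k} {d} {e} Nd≡ιe (nk<e , e<nk+n) =
    ℚP.*-cancelˡ-<-nonNeg N (subst₂ ℚ._<_ (ι-homo-* (+ n) k) (sym Nd≡ιe) (ι-mono-< nk<e)) ,
    ℚP.*-cancelˡ-<-nonNeg N (subst₂ ℚ._<_ (sym Nd≡ιe) (ι-homo-* (+ n) (k ℤ.+ + 1))
      (ι-mono-< (subst (e ℤ.<_) (sym (distrib (+ n) k)) e<nk+n)))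

  witness-determines-point : ∀ {x y : Point n} {m} → IntegralWitness n x m → IntegralWitness n y m →
                             ∀ i → y i ≡ x i
  witness-determines-point {x} {y} iwx iwy i = N*-injective (begin
    N ℚ.* y i                   ≡⟨ recover h N (y i) ⟩
    h ℚ.- special n y i         ≡⟨ cong (ℚ._-_ h) (trans (iwy i) (sym (iwx i))) ⟩
    h ℚ.- special n x i         ≡⟨ recover h N (x i) ⟨
    N ℚ.* x i                   ∎)
    where
    open ≡-Reasoning
    recover : ∀ h N a → N ℚ.* a ≡ h ℚ.- (h ℚ.- N ℚ.* a)
    recover = RingSolver.solve-∀ ℚ-ring

  pointOf : (Fin n → ℤ) → Point n
  pointOf m i = ℚ.1/ N ℚ.* (h ℚ.- ι (m i))

  pointOf-witness : ∀ m → IntegralWitness n (pointOf m) m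
  pointOf-witness m i = begin
    h ℚ.- N ℚ.* (ℚ.1/ N ℚ.* (h ℚ.- ι (m i)))
      ≡⟨ reassociate h N (ℚ.1/ N) (ι (m i)) ⟩
    h ℚ.- N ℚ.* ℚ.1/ N ℚ.* (h ℚ.- ι (m i))
      ≡⟨ cong (λ u → h ℚ.- u ℚ.* (h ℚ.- ι (m i))) (ℚP.*-inverseʳ N) ⟩
    h ℚ.- ℚ.1ℚ ℚ.* (h ℚ.- ι (m i))
      ≡⟨ simplify h (ι (m i)) ⟩
    ι (m i) ∎
    where
    open ≡-Reasoning
    reassociate : ∀ h N u a → h ℚ.- N ℚ.* (u ℚ.* (h ℚ.- a)) ≡ h ℚ.- N ℚ.* u ℚ.* (h ℚ.- a)
    reassociate = RingSolver.solve-∀ ℚ-ring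
    simplify : ∀ h a → h ℚ.- ℚ.1ℚ ℚ.* (h ℚ.- a) ≡ a
    simplify = RingSolver.solve-∀ ℚ-ring

  private
    ι-sum : ∀ {x : Point n} {m} → IntegralWitness n x m → ι (sum m) ≡ N ℚ.* h ℚ.- N ℚ.* sumℚ x
    ι-sum {x} {m} iw = begin
      ι (sum m)                       ≡⟨ sumℚ-ι m ⟨
      sumℚ (ι ∘ m)                    ≡⟨ sumℚ-cong (sym ∘ iw) ⟩
      sumℚ (special n x)              ≡⟨ sumℚ-affine h N x ⟩
      N ℚ.* h ℚ.- N ℚ.* sumℚ x        ∎
      where open ≡-Reasoning

    ι-n[n+1] : ι (+ n ℤ.* + suc n) ≡ N ℚ.* h ℚ.+ N ℚ.* h
    ι-n[n+1] = begin
      ι (+ n ℤ.* + suc n)         ≡⟨ ι-homo-* (+ n) (+ suc n) ⟩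
      N ℚ.* ι (+ suc n)           ≡⟨ cong (N ℚ.*_) h+h ⟨
      N ℚ.* (h ℚ.+ h)             ≡⟨ ℚP.*-distribˡ-+ N h h ⟩
      N ℚ.* h ℚ.+ N ℚ.* h         ∎
      where open ≡-Reasoning

  InV⇒window-sum : ∀ {x : Point n} {m} → IntegralWitness n x m → InV x → sum m ℤ.+ sum m ≡ + n ℤ.* + suc n
  InV⇒window-sum {x} {m} iw x∈V =
    ι-injective (trans (ι-homo-+ (sum m) (sum m)) (trans (cong₂ ℚ._+_ ιΣm ιΣm) (sym ι-n[n+1])))
    where
    drop : ∀ a N → a ℚ.- N ℚ.* ℚ.0ℚ ≡ a
    drop = RingSolver.solve-∀ ℚ-ring
    ιΣm : ι (sum m) ≡ N ℚ.* h
    ιΣm = trans (ι-sum iw) (trans (cong (λ s → N ℚ.* h ℚ.- N ℚ.* s) x∈V) (drop (N ℚ.* h) N))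

  window-sum⇒InV : ∀ {x : Point n} {m} → IntegralWitness n x m → sum m ℤ.+ sum m ≡ + n ℤ.* + suc n → InV x
  window-sum⇒InV {x} {m} iw Σm = N*-injective (begin
    N ℚ.* sumℚ x                               ≡⟨ isolate (N ℚ.* h) (N ℚ.* sumℚ x) ⟩
    N ℚ.* h ℚ.- (N ℚ.* h ℚ.- N ℚ.* sumℚ x)    ≡⟨ cong (ℚ._-_ (N ℚ.* h)) (trans (sym (ι-sum iw)) ιΣm) ⟩
    N ℚ.* h ℚ.- N ℚ.* h                        ≡⟨ vanish (N ℚ.* h) N ⟩
    N ℚ.* ℚ.0ℚ                                 ∎)
    where
    open ≡-Reasoning
    isolate : ∀ a b → b ≡ a ℚ.- (a ℚ.- b)
    isolate = RingSolver.solve-∀ ℚ-ring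
    vanish : ∀ a N → a ℚ.- a ≡ N ℚ.* ℚ.0ℚ
    vanish = RingSolver.solve-∀ ℚ-ring
    ιΣm : ι (sum m) ≡ N ℚ.* h
    ιΣm = ℚ-double-injective (trans (sym (ι-homo-+ (sum m) (sum m))) (trans (cong ι Σm) ι-n[n+1]))

integral-point-in-alcove : ∀ n .{{_ : NonZero n}} (k : Fin n → Fin n → ℤ) → IsAlcove k →
  Σ (Point n) λ x → (InV x × InAlcove k x × IsIntegralPoint n x)
    × ((y : Point n) → InV y → InAlcove k y → IsIntegralPoint n y → ∀ i → y i ≡ x i)
integral-point-in-alcove n k (z , _ , z∈A) = pointOf n W , (x∈V , x∈A , (W , pointOf-witness n W)) , unique
  where
  K : Fin n → Fin n → ℤ
  K = alcoveFloor k
  W : Fin n → ℤ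
  W = window K
  x∈V : InV (pointOf n W)
  x∈V = window-sum⇒InV n {m = W} (pointOf-witness n W)
          (window-sum K (alcoveFloor-diagonal k) (alcoveFloor-antisymmetric k))
  x∈A : InAlcove k (pointOf n W)
  x∈A i j i<j = subst (λ c → ι c ℚ.< d × d ℚ.< ι (c ℤ.+ + 1)) (alcoveFloor-< k i<j)
    (between⇒floor n (witness-diff n {m = W} (pointOf-witness n W) i j)
      (window-between K (alcoveFloor-diagonal k) (alcoveFloor-antisymmetric k)
        (alcoveFloor-cocycle {k = k} {z = z} z∈A)
        i j (λ i≡j → ℕP.<-irrefl (cong toℕ i≡j) i<j)))
    where
    d : ℚ.ℚ
    d = pointOf n W i ℚ.- pointOf n W j
  unique : (y : Point n) → InV y → InAlcove k y → IsIntegralPoint n y → ∀ i → y i ≡ pointOf n W i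
  unique y y∈V y∈A (m , iw) =
    witness-determines-point n {m = W} (pointOf-witness n W) (λ i → trans (iw i) (cong ι (m≡W i)))
    where
    m≡W : ∀ i → m i ≡ W i
    m≡W = window-unique K (alcoveFloor-diagonal k) m
      (λ i j i≢j → floor⇒between n (witness-diff n {m = m} iw i j)
                                     (InAlcove⇒floor {k = k} {z = y} y∈A i j i≢j))
      (InV⇒window-sum n {m = m} iw y∈V)

-- The fundamental alcove

consecutive⇒ordered : ∀ {a ℓ} {A : Set a} (_≺_ : Rel A ℓ) → Transitive _≺_ →
                      ∀ {n} (f : Fin n → A) → (∀ i j → toℕ j ≡ suc (toℕ i) → f j ≺ f i) →
                      ∀ i j → toℕ i ℕ.< toℕ j → f j ≺ f i
consecutive⇒ordered _≺_ ≺-trans f step Fin.zero (Fin.suc Fin.zero) _ = step Fin.zero (Fin.suc Fin.zero) refl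
consecutive⇒ordered _≺_ ≺-trans f step Fin.zero (Fin.suc (Fin.suc j)) _ =
  ≺-trans (consecutive⇒ordered _≺_ ≺-trans (f ∘ Fin.suc) (λ i j e → step (Fin.suc i) (Fin.suc j) (cong suc e))
                               Fin.zero (Fin.suc j) ℕ.z<s)
          (step Fin.zero (Fin.suc Fin.zero) refl)
consecutive⇒ordered _≺_ ≺-trans f step (Fin.suc i) (Fin.suc j) (ℕ.s≤s i<j) =
  consecutive⇒ordered _≺_ ≺-trans (f ∘ Fin.suc) (λ i j e → step (Fin.suc i) (Fin.suc j) (cong suc e)) i j i<j

InA0⇒InAlcove : ∀ {n} {x : Point (suc n)} → InA0 x → InAlcove (λ _ _ → + 0) x
InA0⇒InAlcove {n} {x} (_ , descending , wraps) i j i<j =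
  subst (ℚ._< x i ℚ.- x j) (ℚP.+-inverseʳ (x j)) (ℚP.+-monoˡ-< (ℚ.- x j) (ordered i j i<j)) ,
  ℚP.≤-<-trans (ℚP.+-mono-≤ (x≤x₀ i) (ℚP.neg-antimono-≤ (xₙ≤x j))) span
  where
  ordered : ∀ i j → toℕ i ℕ.< toℕ j → x j ℚ.< x i
  ordered = consecutive⇒ordered ℚ._<_ ℚP.<-trans x descending
  last : Fin (suc n)
  last = Fin.fromℕ n
  x≤x₀ : ∀ i → x i ℚ.≤ x Fin.zero
  x≤x₀ Fin.zero    = ℚP.≤-refl
  x≤x₀ (Fin.suc i) = ℚP.<⇒≤ (ordered Fin.zero (Fin.suc i) ℕ.z<s)
  xₙ≤x : ∀ j → x last ℚ.≤ x j
  xₙ≤x j with ℕP.m≤n⇒m<n∨m≡n (FinP.toℕ≤pred[n] j)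
  ... | inj₁ j<n = ℚP.<⇒≤ (ordered j last (subst (toℕ j ℕ.<_) (sym (FinP.toℕ-fromℕ n)) j<n))
  ... | inj₂ j≡n = ℚP.≤-reflexive (cong x (FinP.toℕ-injective (trans (FinP.toℕ-fromℕ n) (sym j≡n))))
  span : x Fin.zero ℚ.- x last ℚ.< ℚ.1ℚ
  span = subst₂ ℚ._<_ (telescope (x Fin.zero) (x last)) (cancel (x last))
    (ℚP.+-monoˡ-< (ℚ.1ℚ ℚ.- x last) (wraps Fin.zero last refl (FinP.toℕ-fromℕ n)))
    where
    telescope : ∀ a b → a ℚ.- ℚ.1ℚ ℚ.+ (ℚ.1ℚ ℚ.- b) ≡ a ℚ.- b
    telescope = RingSolver.solve-∀ ℚ-ring
    cancel : ∀ b → b ℚ.+ (ℚ.1ℚ ℚ.- b) ≡ ℚ.1ℚ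
    cancel = RingSolver.solve-∀ ℚ-ring

private
  ascending-between : ∀ {n} {i j : Fin n} → toℕ i ℕ.< toℕ j →
                      BetweenMultiples n (+ 0) (+ suc (toℕ j) ℤ.- + suc (toℕ i))
  ascending-between {n} {i} {j} i<j =
    subst (BetweenMultiples n (+ 0)) (sym (cancel-suc (+ toℕ j) (+ toℕ i))) (difference-between i<j (FinP.toℕ<n j))
    where
    cancel-suc : ∀ a b → (+ 1 ℤ.+ a) ℤ.- (+ 1 ℤ.+ b) ≡ a ℤ.- b
    cancel-suc = solve-∀

standard-between : ∀ {n} (i j : Fin n) → i ≢ j →
                   BetweenMultiples n (alcoveFloor (λ _ _ → + 0) i j) (+ suc (toℕ j) ℤ.- + suc (toℕ i))
standard-between {n} i j i≢j with FinP.<-cmp i j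
... | tri< i<j _ _ = ascending-between i<j
... | tri≈ _ i≡j _ = ⊥-elim (i≢j i≡j)
... | tri> _ _ j<i = subst (BetweenMultiples n (ℤ.- + 0 ℤ.- + 1)) (negate (+ suc (toℕ i)) (+ suc (toℕ j)))
                           (between-neg {n} {+ 0} (ascending-between {n} j<i))
  where
  negate : ∀ a b → ℤ.- (a ℤ.- b) ≡ b ℤ.- a
  negate = solve-∀

standard-sum : ∀ n → sum {n} (λ i → + suc (toℕ i)) ℤ.+ sum {n} (λ i → + suc (toℕ i)) ≡ + n ℤ.* + suc n
standard-sum n = begin
  S ℤ.+ S                         ≡⟨ cong₂ ℤ._+_ (ℤP.+-identityˡ S) (ℤP.+-identityˡ S) ⟨
  (+ 0 ℤ.+ S) ℤ.+ (+ 0 ℤ.+ S)     ≡⟨ sum-toℕ (suc n) ⟩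
  + suc n ℤ.* (+ suc n ℤ.- + 1)   ≡⟨ reorder (+ n) ⟩
  + n ℤ.* + suc n                 ∎
  where
  open ≡-Reasoning
  S : ℤ
  S = sum {n} (λ i → + suc (toℕ i))
  reorder : ∀ a → (+ 1 ℤ.+ a) ℤ.* ((+ 1 ℤ.+ a) ℤ.- + 1) ≡ a ℤ.* (+ 1 ℤ.+ a)
  reorder = solve-∀

A0-window : ∀ {n} {x : Point (suc n)} {m} → InA0 x → IntegralWitness (suc n) x m → ∀ i → m i ≡ + suc (toℕ i)
A0-window {n} {x} {m} x∈A0 iw i =
  trans (window-unique K diagonal m m-between (InV⇒window-sum (suc n) {m = m} iw (proj₁ x∈A0)) i)
        (sym (window-unique K diagonal (λ j → + suc (toℕ j)) standard-between (standard-sum (suc n)) i))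
  where
  K : Fin (suc n) → Fin (suc n) → ℤ
  K = alcoveFloor (λ _ _ → + 0)
  diagonal : ∀ i → K i i ≡ + 0
  diagonal = alcoveFloor-diagonal (λ _ _ → + 0)
  m-between : ∀ i j → i ≢ j → BetweenMultiples (suc n) (K i j) (m j ℤ.- m i)
  m-between i j i≢j = floor⇒between (suc n) (witness-diff (suc n) {m = m} iw i j)
    (InAlcove⇒floor {k = λ _ _ → + 0} {z = x} (InA0⇒InAlcove x∈A0) i j i≢j)

-- The generators acting on ℤ

private
  remainders-apart : ∀ {n a b} q q′ → a ℕ.< b → b ℕ.< n → + a ℤ.+ q ℤ.* + n ≢ + b ℤ.+ q′ ℤ.* + n
  remainders-apart {n} {a} {b} q q′ a<b b<n eq = multiple-not-between n (+ 0) (q ℤ.- q′)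
    (subst (BetweenMultiples n (+ 0)) b-a≡n[q-q′] (difference-between a<b b<n))
    where
    regroup : ∀ a b q q′ m → b ℤ.- a ≡ (b ℤ.+ q′ ℤ.* m) ℤ.- (a ℤ.+ q ℤ.* m) ℤ.+ m ℤ.* (q ℤ.- q′)
    regroup = solve-∀
    cancel : ∀ s t → s ℤ.- s ℤ.+ t ≡ t
    cancel = solve-∀
    b-a≡n[q-q′] : + b ℤ.- + a ≡ + n ℤ.* (q ℤ.- q′)
    b-a≡n[q-q′] = trans (regroup (+ a) (+ b) q q′ (+ n))
      (trans (cong (λ s → s ℤ.- (+ a ℤ.+ q ℤ.* + n) ℤ.+ + n ℤ.* (q ℤ.- q′)) (sym eq))
             (cancel (+ a ℤ.+ q ℤ.* + n) (+ n ℤ.* (q ℤ.- q′))))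

remainder-unique : ∀ {n r r′} q q′ → r ℕ.< n → r′ ℕ.< n → + r ℤ.+ q ℤ.* + n ≡ + r′ ℤ.+ q′ ℤ.* + n → r ≡ r′
remainder-unique {n} {r} {r′} q q′ r<n r′<n eq with ℕP.<-cmp r r′
... | tri< r<r′ _ _ = ⊥-elim (remainders-apart q q′ r<r′ r′<n eq)
... | tri≈ _ r≡r′ _ = r≡r′
... | tri> _ _ r′<r = ⊥-elim (remainders-apart q′ q r′<r r<n (sym eq))

module _ {n : ℕ} .{{_ : NonZero n}} where

  %ℕ-periodic : ∀ z q → (z ℤ.- + n ℤ.* q) ℤ.%ℕ n ≡ z ℤ.%ℕ n
  %ℕ-periodic z q = remainder-unique ((z ℤ.- + n ℤ.* q) ℤ./ℕ n) (z ℤ./ℕ n ℤ.- q)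
    (ℤDivMod.n%ℕd<d (z ℤ.- + n ℤ.* q) n) (ℤDivMod.n%ℕd<d z n) (begin
      + ((z ℤ.- + n ℤ.* q) ℤ.%ℕ n) ℤ.+ (z ℤ.- + n ℤ.* q) ℤ./ℕ n ℤ.* + n
        ≡⟨ ℤDivMod.a≡a%ℕn+[a/ℕn]*n (z ℤ.- + n ℤ.* q) n ⟨
      z ℤ.- + n ℤ.* q
        ≡⟨ cong (ℤ._- + n ℤ.* q) (ℤDivMod.a≡a%ℕn+[a/ℕn]*n z n) ⟩
      + (z ℤ.%ℕ n) ℤ.+ z ℤ./ℕ n ℤ.* + n ℤ.- + n ℤ.* q
        ≡⟨ regroup (+ (z ℤ.%ℕ n)) (z ℤ./ℕ n) q (+ n) ⟩
      + (z ℤ.%ℕ n) ℤ.+ (z ℤ./ℕ n ℤ.- q) ℤ.* + n ∎)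
    where
    open ≡-Reasoning
    regroup : ∀ r s q m → r ℤ.+ s ℤ.* m ℤ.- m ℤ.* q ≡ r ℤ.+ (s ℤ.- q) ℤ.* m
    regroup = solve-∀

  sZ-up : ∀ g z → z ℤ.%ℕ n ≡ toℕ g → sZ g z ≡ z ℤ.+ + 1
  sZ-up g z r≡g with z ℤ.%ℕ n ℕP.≟ toℕ g
  ... | yes _   = refl
  ... | no r≢g = ⊥-elim (r≢g r≡g)

  sZ-down : ∀ g z → z ℤ.%ℕ n ≢ toℕ g → z ℤ.%ℕ n ≡ suc (toℕ g) ℕ.% n → sZ g z ≡ z ℤ.- + 1
  sZ-down g z r≢g r≡g+1 with z ℤ.%ℕ n ℕP.≟ toℕ g
  ... | yes r≡g = ⊥-elim (r≢g r≡g)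
  ... | no _ with z ℤ.%ℕ n ℕP.≟ suc (toℕ g) ℕ.% n
  ...   | yes _     = refl
  ...   | no r≢g+1 = ⊥-elim (r≢g+1 r≡g+1)

  sZ-fixed : ∀ g z → z ℤ.%ℕ n ≢ toℕ g → z ℤ.%ℕ n ≢ suc (toℕ g) ℕ.% n → sZ g z ≡ z
  sZ-fixed g z r≢g r≢g+1 with z ℤ.%ℕ n ℕP.≟ toℕ g
  ... | yes r≡g = ⊥-elim (r≢g r≡g)
  ... | no _ with z ℤ.%ℕ n ℕP.≟ suc (toℕ g) ℕ.% n
  ...   | yes r≡g+1 = ⊥-elim (r≢g+1 r≡g+1)
  ...   | no _       = refl

  private
    shift-comm : ∀ a b c → a ℤ.- c ℤ.+ b ≡ a ℤ.+ b ℤ.- c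
    shift-comm = solve-∀

  sZ-periodic : ∀ g z q → sZ g (z ℤ.- + n ℤ.* q) ≡ sZ g z ℤ.- + n ℤ.* q
  sZ-periodic g z q with z ℤ.%ℕ n ℕP.≟ toℕ g
  ... | yes r≡g = trans (sZ-up g (z ℤ.- + n ℤ.* q) (trans (%ℕ-periodic z q) r≡g)) (shift-comm z (+ 1) (+ n ℤ.* q))
  ... | no r≢g with z ℤ.%ℕ n ℕP.≟ suc (toℕ g) ℕ.% n
  ...   | yes r≡g+1 = trans (sZ-down g (z ℤ.- + n ℤ.* q) (r≢g ∘ trans (sym (%ℕ-periodic z q))) (trans (%ℕ-periodic z q) r≡g+1))
                            (shift-comm z (ℤ.- + 1) (+ n ℤ.* q))
  ...   | no r≢g+1  = sZ-fixed g (z ℤ.- + n ℤ.* q) (r≢g ∘ trans (sym (%ℕ-periodic z q))) (r≢g+1 ∘ trans (sym (%ℕ-periodic z q)))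

  wordZ-periodic : ∀ w z q → wordZ w (z ℤ.- + n ℤ.* q) ≡ wordZ w z ℤ.- + n ℤ.* q
  wordZ-periodic []      z q = refl
  wordZ-periodic (g ∷ w) z q = trans (cong (sZ g) (wordZ-periodic w z q)) (sZ-periodic g (wordZ w z) q)

-- The generators acting on V

special-translate : ∀ {n} {x y : Point n} {i j a c} →
                    special n x i ≡ ι a → y j ≡ x i ℚ.+ ι c → special n y j ≡ ι (a ℤ.- + n ℤ.* c)
special-translate {n} {x} {y} {i} {j} {a} {c} x-special y≡x+c = begin
  h ℚ.- N ℚ.* y j                       ≡⟨ cong (λ t → h ℚ.- N ℚ.* t) y≡x+c ⟩
  h ℚ.- N ℚ.* (x i ℚ.+ ι c)             ≡⟨ distribute h N (x i) (ι c) ⟩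
  (h ℚ.- N ℚ.* x i) ℚ.- N ℚ.* ι c       ≡⟨ cong₂ ℚ._-_ x-special (sym (ι-homo-* (+ n) c)) ⟩
  ι a ℚ.- ι (+ n ℤ.* c)                 ≡⟨ ι-homo-sub a (+ n ℤ.* c) ⟨
  ι (a ℤ.- + n ℤ.* c)                   ∎
  where
  open ≡-Reasoning
  N h : ℚ.ℚ
  N = ι (+ n)
  h = + suc n ℚ./ 2
  distribute : ∀ h N a c → h ℚ.- N ℚ.* (a ℚ.+ c) ≡ (h ℚ.- N ℚ.* a) ℚ.- N ℚ.* c
  distribute = RingSolver.solve-∀ ℚ-ring

witness-unique : ∀ {n} {x : Point n} {m m′} → IntegralWitness n x m → IntegralWitness n x m′ → ∀ i → m i ≡ m′ i
witness-unique iw iw′ i = ι-injective (trans (sym (iw i)) (iw′ i))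

witness-resp : ∀ {n} {x y : Point n} {m} → (∀ i → y i ≡ x i) → IntegralWitness n x m → IntegralWitness n y m
witness-resp {n} y≡x iw i = trans (cong (λ t → (+ suc n ℚ./ 2) ℚ.- ι (+ n) ℚ.* t) (y≡x i)) (iw i)

module _ {n′ : ℕ} where

  private
    n : ℕ
    n = suc (suc n′)

  -- Coordinates are 0-indexed: s_g swaps coordinates g and leftOf g = g − 1 (mod n), and for s₀
  -- the swap is affine, (s₀ x)₀ = x_{n−1} + 1 and (s₀ x)_{n−1} = x₀ − 1, as recorded by wrap.
  leftOf : Fin n → Fin n
  leftOf Fin.zero    = Fin.fromℕ (suc n′)
  leftOf (Fin.suc g) = Fin.inject₁ g

  wrap : Fin n → ℤ
  wrap Fin.zero    = + 1
  wrap (Fin.suc _) = + 0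

  toℕ-leftOf-≢ : ∀ g → toℕ (leftOf g) ≢ toℕ g
  toℕ-leftOf-≢ Fin.zero    eq = ℕP.0≢1+n (sym (trans (sym (FinP.toℕ-fromℕ (suc n′))) eq))
  toℕ-leftOf-≢ (Fin.suc g) eq = ℕP.1+n≢n (sym (trans (sym (FinP.toℕ-inject₁ g)) eq))

  suc-leftOf-% : ∀ g → suc (toℕ (leftOf g)) ℕ.% n ≡ toℕ g
  suc-leftOf-% Fin.zero    = trans (cong (λ t → suc t ℕ.% n) (FinP.toℕ-fromℕ (suc n′))) (ℕDivMod.n%n≡0 n)
  suc-leftOf-% (Fin.suc g) = trans (cong (λ t → suc t ℕ.% n) (FinP.toℕ-inject₁ g))
                                   (ℕDivMod.m<n⇒m%n≡m (FinP.toℕ<n (Fin.suc g)))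

  leftOf-wrap : ∀ g → + suc (toℕ (leftOf g)) ≡ + toℕ g ℤ.+ + n ℤ.* wrap g
  leftOf-wrap Fin.zero    = trans (cong (λ t → + suc t) (FinP.toℕ-fromℕ (suc n′)))
                                  (sym (trans (ℤP.+-identityˡ (+ n ℤ.* + 1)) (ℤP.*-identityʳ (+ n))))
  leftOf-wrap (Fin.suc g) = trans (cong (λ t → + suc t) (FinP.toℕ-inject₁ g))
                                  (sym (trans (cong (ℤ._+_ (+ suc (toℕ g))) (ℤP.*-zeroʳ (+ n))) (ℤP.+-identityʳ _)))

  suc-%-injective : ∀ {a b} → a ℕ.< n → b ℕ.< n → suc a ℕ.% n ≡ suc b ℕ.% n → a ≡ b
  suc-%-injective {a} {b} a<n b<n eq with ℕP.m≤n⇒m<n∨m≡n a<n | ℕP.m≤n⇒m<n∨m≡n b<n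
  ... | inj₁ 1+a<n | inj₁ 1+b<n = ℕP.suc-injective
          (trans (sym (ℕDivMod.m<n⇒m%n≡m 1+a<n)) (trans eq (ℕDivMod.m<n⇒m%n≡m 1+b<n)))
  ... | inj₁ 1+a<n | inj₂ 1+b≡n = ⊥-elim (ℕP.0≢1+n (sym
          (trans (sym (ℕDivMod.m<n⇒m%n≡m 1+a<n)) (trans eq (trans (cong (ℕ._% n) 1+b≡n) (ℕDivMod.n%n≡0 n))))))
  ... | inj₂ 1+a≡n | inj₁ 1+b<n = ⊥-elim (ℕP.0≢1+n (sym
          (trans (sym (ℕDivMod.m<n⇒m%n≡m 1+b<n)) (trans (sym eq) (trans (cong (ℕ._% n) 1+a≡n) (ℕDivMod.n%n≡0 n))))))
  ... | inj₂ 1+a≡n | inj₂ 1+b≡n = ℕP.suc-injective (trans 1+a≡n (sym 1+b≡n))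

  sZ-at-leftOf : ∀ g → sZ g (+ suc (toℕ (leftOf g))) ≡ + suc (toℕ (leftOf g)) ℤ.+ + 1
  sZ-at-leftOf g = sZ-up g (+ suc (toℕ (leftOf g))) (suc-leftOf-% g)

  sZ-at : ∀ g → sZ g (+ suc (toℕ g)) ≡ + suc (toℕ g) ℤ.- + 1
  sZ-at g = sZ-down g (+ suc (toℕ g))
    (λ eq → toℕ-leftOf-≢ g (sym (suc-%-injective (FinP.toℕ<n g) (FinP.toℕ<n (leftOf g)) (trans eq (sym (suc-leftOf-% g))))))
    refl

  sZ-elsewhere : ∀ g j → toℕ j ≢ toℕ g → toℕ j ≢ toℕ (leftOf g) → sZ g (+ suc (toℕ j)) ≡ + suc (toℕ j)
  sZ-elsewhere g j j≢g j≢l = sZ-fixed g (+ suc (toℕ j))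
    (λ eq → j≢l (suc-%-injective (FinP.toℕ<n j) (FinP.toℕ<n (leftOf g)) (trans eq (sym (suc-leftOf-% g)))))
    (λ eq → j≢g (suc-%-injective (FinP.toℕ<n j) (FinP.toℕ<n g) eq))

  toℕ-idx : ∀ {t} (j : Fin n) → t ℕ.< n → toℕ (idx t j) ≡ t
  toℕ-idx {t} j t<n with t ℕ.<? n
  ... | yes t<n′ = FinP.toℕ-fromℕ< t<n′
  ... | no t≮n   = ⊥-elim (t≮n t<n)

  sV-at : ∀ g (x : Point n) {j} → toℕ j ≡ toℕ g → sV g x j ≡ x (leftOf g) ℚ.+ ι (wrap g)
  sV-at Fin.zero x {j} j≡g with toℕ j ℕP.≟ 0
  ... | yes _   = cong (λ k → x k ℚ.+ ℚ.1ℚ)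
                    (FinP.toℕ-injective (trans (toℕ-idx j (ℕP.n<1+n (suc n′))) (sym (FinP.toℕ-fromℕ (suc n′)))))
  ... | no j≢0 = ⊥-elim (j≢0 j≡g)
  sV-at (Fin.suc g) x {j} j≡g with toℕ j ℕP.≟ toℕ g
  ... | yes j≡g′ = ⊥-elim (ℕP.1+n≢n (trans (sym j≡g) j≡g′))
  ... | no _ with toℕ j ℕP.≟ suc (toℕ g)
  ...   | yes _    = trans (cong x (FinP.toℕ-injective (trans (toℕ-idx j (ℕP.m<n⇒m<1+n (FinP.toℕ<n g)))
                                                             (sym (FinP.toℕ-inject₁ g)))))
                           (sym (ℚP.+-identityʳ _))
  ...   | no j≢g  = ⊥-elim (j≢g j≡g)

  sV-at-leftOf : ∀ g (x : Point n) {j} → toℕ j ≡ toℕ (leftOf g) → sV g x j ≡ x g ℚ.- ι (wrap g)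
  sV-at-leftOf Fin.zero x {j} j≡l with toℕ j ℕP.≟ 0
  ... | yes j≡0 = ⊥-elim (ℕP.0≢1+n (trans (sym j≡0) (trans j≡l (FinP.toℕ-fromℕ (suc n′)))))
  ... | no _ with toℕ j ℕP.≟ suc n′
  ...   | yes _     = cong (λ k → x k ℚ.- ℚ.1ℚ) (FinP.toℕ-injective (toℕ-idx j ℕ.z<s))
  ...   | no j≢n′  = ⊥-elim (j≢n′ (trans j≡l (FinP.toℕ-fromℕ (suc n′))))
  sV-at-leftOf (Fin.suc g) x {j} j≡l with toℕ j ℕP.≟ toℕ g
  ... | yes _    = trans (cong x (FinP.toℕ-injective (toℕ-idx j (FinP.toℕ<n (Fin.suc g))))) (sym (ℚP.+-identityʳ _))
  ... | no j≢g  = ⊥-elim (j≢g (trans j≡l (FinP.toℕ-inject₁ g)))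

  sV-elsewhere : ∀ g (x : Point n) {j} → toℕ j ≢ toℕ g → toℕ j ≢ toℕ (leftOf g) → sV g x j ≡ x j
  sV-elsewhere Fin.zero x {j} j≢g j≢l with toℕ j ℕP.≟ 0
  ... | yes j≡0 = ⊥-elim (j≢g j≡0)
  ... | no _ with toℕ j ℕP.≟ suc n′
  ...   | yes j≡n′ = ⊥-elim (j≢l (trans j≡n′ (sym (FinP.toℕ-fromℕ (suc n′)))))
  ...   | no _      = refl
  sV-elsewhere (Fin.suc g) x {j} j≢g j≢l with toℕ j ℕP.≟ toℕ g
  ... | yes j≡g′ = ⊥-elim (j≢l (trans j≡g′ (sym (FinP.toℕ-inject₁ g))))
  ... | no _ with toℕ j ℕP.≟ suc (toℕ g)
  ...   | yes j≡g = ⊥-elim (j≢g j≡g)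
  ...   | no _     = refl

  partner : Fin n → Fin n → Fin n
  partner g j with j FinP.≟ g
  ... | yes _ = leftOf g
  ... | no _ with j FinP.≟ leftOf g
  ...   | yes _ = g
  ...   | no _  = j

  shift : Fin n → Fin n → ℤ
  shift g j with j FinP.≟ g
  ... | yes _ = wrap g
  ... | no _ with j FinP.≟ leftOf g
  ...   | yes _ = ℤ.- wrap g
  ...   | no _  = + 0

  private
    leftOf≢ : ∀ g → leftOf g ≢ g
    leftOf≢ g = toℕ-leftOf-≢ g ∘ cong toℕ

  partner-at : ∀ g → partner g g ≡ leftOf g
  partner-at g with g FinP.≟ g
  ... | yes _   = refl
  ... | no g≢g = ⊥-elim (g≢g refl)

  partner-at-leftOf : ∀ g → partner g (leftOf g) ≡ g
  partner-at-leftOf g with leftOf g FinP.≟ g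
  ... | yes l≡g = ⊥-elim (leftOf≢ g l≡g)
  ... | no _ with leftOf g FinP.≟ leftOf g
  ...   | yes _   = refl
  ...   | no l≢l = ⊥-elim (l≢l refl)

  partner-elsewhere : ∀ g {j} → j ≢ g → j ≢ leftOf g → partner g j ≡ j
  partner-elsewhere g {j} j≢g j≢l with j FinP.≟ g
  ... | yes j≡g = ⊥-elim (j≢g j≡g)
  ... | no _ with j FinP.≟ leftOf g
  ...   | yes j≡l = ⊥-elim (j≢l j≡l)
  ...   | no _     = refl

  shift-at : ∀ g → shift g g ≡ wrap g
  shift-at g with g FinP.≟ g
  ... | yes _   = refl
  ... | no g≢g = ⊥-elim (g≢g refl)

  shift-at-leftOf : ∀ g → shift g (leftOf g) ≡ ℤ.- wrap g
  shift-at-leftOf g with leftOf g FinP.≟ g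
  ... | yes l≡g = ⊥-elim (leftOf≢ g l≡g)
  ... | no _ with leftOf g FinP.≟ leftOf g
  ...   | yes _   = refl
  ...   | no l≢l = ⊥-elim (l≢l refl)

  shift-elsewhere : ∀ g {j} → j ≢ g → j ≢ leftOf g → shift g j ≡ + 0
  shift-elsewhere g {j} j≢g j≢l with j FinP.≟ g
  ... | yes j≡g = ⊥-elim (j≢g j≡g)
  ... | no _ with j FinP.≟ leftOf g
  ...   | yes j≡l = ⊥-elim (j≢l j≡l)
  ...   | no _     = refl

  partner-involutive : ∀ g j → partner g (partner g j) ≡ j
  partner-involutive g j with j FinP.≟ g
  ... | yes refl = partner-at-leftOf g
  ... | no j≢g with j FinP.≟ leftOf g
  ...   | yes refl = partner-at g
  ...   | no j≢l   = partner-elsewhere g j≢g j≢l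

  shift-partner : ∀ g j → shift g (partner g j) ≡ ℤ.- shift g j
  shift-partner g j with j FinP.≟ g
  ... | yes refl = shift-at-leftOf g
  ... | no j≢g with j FinP.≟ leftOf g
  ...   | yes refl = trans (shift-at g) (sym (ℤP.neg-involutive (wrap g)))
  ...   | no j≢l   = shift-elsewhere g j≢g j≢l

  sV-partner : ∀ g (x : Point n) j → sV g x j ≡ x (partner g j) ℚ.+ ι (shift g j)
  sV-partner g x j with j FinP.≟ g
  ... | yes refl = sV-at g x refl
  ... | no j≢g with j FinP.≟ leftOf g
  ...   | yes refl = trans (sV-at-leftOf g x refl) (cong (ℚ._+_ (x g)) (sym (ι-homo‿- (wrap g))))
  ...   | no j≢l   = trans (sV-elsewhere g x (j≢g ∘ FinP.toℕ-injective) (j≢l ∘ FinP.toℕ-injective))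
                           (sym (ℚP.+-identityʳ (x j)))

  sV-partner⁻¹ : ∀ g (x : Point n) j → x j ≡ sV g x (partner g j) ℚ.+ ι (shift g j)
  sV-partner⁻¹ g x j = sym (begin
    sV g x (partner g j) ℚ.+ ι (shift g j)
      ≡⟨ cong (ℚ._+ ι (shift g j)) (sV-partner g x (partner g j)) ⟩
    x (partner g (partner g j)) ℚ.+ ι (shift g (partner g j)) ℚ.+ ι (shift g j)
      ≡⟨ cong₂ (λ k s → x k ℚ.+ ι s ℚ.+ ι (shift g j)) (partner-involutive g j) (shift-partner g j) ⟩
    x j ℚ.+ ι (ℤ.- shift g j) ℚ.+ ι (shift g j)
      ≡⟨ cong (λ t → x j ℚ.+ t ℚ.+ ι (shift g j)) (ι-homo‿- (shift g j)) ⟩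
    x j ℚ.+ ℚ.- ι (shift g j) ℚ.+ ι (shift g j)
      ≡⟨ cancel (x j) (ι (shift g j)) ⟩
    x j ∎)
    where
    open ≡-Reasoning
    cancel : ∀ a c → a ℚ.+ ℚ.- c ℚ.+ c ≡ a
    cancel = RingSolver.solve-∀ ℚ-ring

  sZ-partner : ∀ g j → sZ g (+ suc (toℕ (partner g j)) ℤ.- + n ℤ.* shift g j) ≡ + suc (toℕ j)
  sZ-partner g j with j FinP.≟ g
  ... | yes refl = begin
    sZ g (+ suc (toℕ (leftOf g)) ℤ.- + n ℤ.* wrap g)
      ≡⟨ sZ-periodic g (+ suc (toℕ (leftOf g))) (wrap g) ⟩
    sZ g (+ suc (toℕ (leftOf g))) ℤ.- + n ℤ.* wrap g
      ≡⟨ cong (ℤ._- + n ℤ.* wrap g) (sZ-at-leftOf g) ⟩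
    + suc (toℕ (leftOf g)) ℤ.+ + 1 ℤ.- + n ℤ.* wrap g
      ≡⟨ cong (λ t → t ℤ.+ + 1 ℤ.- + n ℤ.* wrap g) (leftOf-wrap g) ⟩
    + toℕ g ℤ.+ + n ℤ.* wrap g ℤ.+ + 1 ℤ.- + n ℤ.* wrap g
      ≡⟨ unwrap (+ toℕ g) (+ n ℤ.* wrap g) ⟩
    + suc (toℕ g) ∎
    where
    open ≡-Reasoning
    unwrap : ∀ a c → a ℤ.+ c ℤ.+ + 1 ℤ.- c ≡ + 1 ℤ.+ a
    unwrap = solve-∀
  ... | no j≢g with j FinP.≟ leftOf g
  ...   | yes refl = begin
    sZ g (+ suc (toℕ g) ℤ.- + n ℤ.* ℤ.- wrap g)
      ≡⟨ sZ-periodic g (+ suc (toℕ g)) (ℤ.- wrap g) ⟩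
    sZ g (+ suc (toℕ g)) ℤ.- + n ℤ.* ℤ.- wrap g
      ≡⟨ cong (ℤ._- + n ℤ.* ℤ.- wrap g) (sZ-at g) ⟩
    + suc (toℕ g) ℤ.- + 1 ℤ.- + n ℤ.* ℤ.- wrap g
      ≡⟨ rewrap (+ toℕ g) (+ n) (wrap g) ⟩
    + toℕ g ℤ.+ + n ℤ.* wrap g
      ≡⟨ leftOf-wrap g ⟨
    + suc (toℕ (leftOf g)) ∎
    where
    open ≡-Reasoning
    rewrap : ∀ a m w → (+ 1 ℤ.+ a) ℤ.- + 1 ℤ.- m ℤ.* ℤ.- w ≡ a ℤ.+ m ℤ.* w
    rewrap = solve-∀
  ...   | no j≢l = trans (cong (sZ g) (drop-zero (+ suc (toℕ j)) (+ n)))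
                         (sZ-elsewhere g j (j≢g ∘ FinP.toℕ-injective) (j≢l ∘ FinP.toℕ-injective))
    where
    drop-zero : ∀ a m → a ℤ.- m ℤ.* + 0 ≡ a
    drop-zero = solve-∀

  windowAction : Fin n → (Fin n → ℤ) → Fin n → ℤ
  windowAction g m j = m (partner g j) ℤ.- + n ℤ.* shift g j

  sV-witness : ∀ g {x : Point n} {m} → IntegralWitness n x m → IntegralWitness n (sV g x) (windowAction g m)
  sV-witness g {x} {m} iw j = special-translate {x = x} {y = sV g x} {partner g j} {j} {m (partner g j)} {shift g j}
                                 (iw (partner g j)) (sV-partner g x j)

  sV-witness⁻¹ : ∀ g {x : Point n} {m} → IntegralWitness n (sV g x) m → IntegralWitness n x (windowAction g m)
  sV-witness⁻¹ g {x} {m} iw j = special-translate {x = sV g x} {y = x} {partner g j} {j} {m (partner g j)} {shift g j}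
                                   (iw (partner g j)) (sV-partner⁻¹ g x j)

  word-window : ∀ w {y : Point n} → InA0 y → ∀ m → IntegralWitness n (wordV w y) m → ∀ i → wordZ w (m i) ≡ + suc (toℕ i)
  word-window []      y∈A₀ m iw = A0-window y∈A₀ iw
  word-window (g ∷ w) {y} y∈A₀ m iw i = begin
    sZ g (wordZ w (m i))
      ≡⟨ cong (sZ g ∘ wordZ w) (witness-unique {m = m} {windowAction g m′} iw (sV-witness g {m = m′} iw′) i) ⟩
    sZ g (wordZ w (m′ (partner g i) ℤ.- + n ℤ.* shift g i))
      ≡⟨ cong (sZ g) (wordZ-periodic w (m′ (partner g i)) (shift g i)) ⟩
    sZ g (wordZ w (m′ (partner g i)) ℤ.- + n ℤ.* shift g i)
      ≡⟨ cong (λ z → sZ g (z ℤ.- + n ℤ.* shift g i)) (word-window w y∈A₀ m′ iw′ (partner g i)) ⟩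
    sZ g (+ suc (toℕ (partner g i)) ℤ.- + n ℤ.* shift g i)
      ≡⟨ sZ-partner g i ⟩
    + suc (toℕ i) ∎
    where
    open ≡-Reasoning
    m′ : Fin n → ℤ
    m′ = windowAction g m
    iw′ : IntegralWitness n (wordV w y) m′
    iw′ = sV-witness⁻¹ g {m = m} iw

mainTheorem18 : (n : ℕ) → .{{_ : NonZero n}} → 2 ≤ n →
    -- every alcove contains exactly one point with all (n+1)/2 - n x_i integral
    ((k : Fin n → Fin n → ℤ) → IsAlcove k →
      Σ (Point n) λ x → (InV x × InAlcove k x × IsIntegralPoint n x)
        × ((y : Point n) → InV y → InAlcove k y → IsIntegralPoint n y → ∀ i → y i ≡ x i))
    ×
    -- if x ∈ ω(A₀) is such a point then ω⁻¹(i) = (n+1)/2 - n x_i, i.e. ω(m_i) = i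
    ((w : List (Fin n)) (x : Point n) →
      Σ (Point n) (λ y → InA0 y × (∀ i → wordV w y i ≡ x i)) →
      (m : Fin n → ℤ) → IntegralWitness n x m →
      ∀ i → wordZ w (m i) ≡ + (suc (toℕ i)))
mainTheorem18 ℕ.zero ()
mainTheorem18 (suc ℕ.zero) (ℕ.s≤s ())
mainTheorem18 n@(suc (suc _)) _ =
  integral-point-in-alcove n ,
  λ w x (y , y∈A₀ , wy≡x) m iw → word-window w y∈A₀ m (witness-resp {m = m} wy≡x iw)
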